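{- Let $\alpha,\beta$ be parameters, $n\ge1$, $x_1,\dots,x_n$ variables and $\lambda$ a partition. Then $g^{(\alpha,\beta)}_\lambda(x_1,\dots,x_n)$ equals the partition function of the following lattice model: $n$ rows with bosonic horizontal labels (nonnegative integers), row $k$ (from the bottom) having parameter $x_k$, bottom boundary all $0$, top boundary $(m_j(\lambda))_{j\ge1}$, right boundary value $0$, free left boundary, and vertex weights $$w_x(a,b;c,d)=\delta_{a+b,c+d}\begin{cases}(\alpha+\beta)^{a-d-1}(x+\alpha)\beta^{d}& a>d,\\ \beta^{a-1}x& 0<a\le d,\\ 1& a=0.\end{cases}$$
   Context: Dual canonical Grothendieck polynomials. For partitions $\mu\subseteq\lambda$ let $r(\lambda/\mu)$, $c(\lambda/\mu)$, $b(\lambda/\mu)$ be the numbers of nonempty rows, nonempty columns, and edge-connected components of the skew diagram $\lambda/\mu$. The polynomials $g^{(\alpha,\beta)}_\lambda$ are determined by: with no variables, $g^{(\alpha,\beta)}_\lambda()=1$ if $\lambda=\emptyset$ and $0$ otherwise; and $g^{(\alpha,\beta)}_\lambda(x_1,\dots,x_{n+1})=\sum_{\mu\subseteq\lambda}g^{(\alpha,\beta)}_\mu(x_1,\dots,x_n)\,g^{(\alpha,\beta)}_{\lambda/\mu}(x_{n+1})$ with $g^{(\alpha,\beta)}_{\lambda/\mu}(x)=\beta^{r-b}(\alpha+\beta)^{|\lambda|-|\mu|-r-c+b}x^{b}(\alpha+x)^{c-b}$, where $r,c,b$ denote $r(\lambda/\mu),c(\lambda/\mu),b(\lambda/\mu)$.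 Lattice conventions. A vertex has left label $a$, bottom label $b$, right label $c$, top label $d$. A row with parameter $x$ is a sequence of vertices at sites $j=1,2,\dots$, the right label at site $j$ being the left label at site $j+1$; vertical labels are nonnegative integers; the left label at site 1 is free (summed over all values) and the right labels must be eventually equal to the prescribed right boundary value. Rows $1,\dots,n$ are stacked bottom to top, top labels of row $k$ = bottom labels of row $k+1$; bottom labels of row 1 and top labels of row $n$ are prescribed. The partition function is the sum over all labelings of non-prescribed edges of the product of the vertex weights. $m_j(\lambda)$ is the number of parts of $\lambda$ equal to $j$. -}

module Defs where

open import Level using (Level)
open import Algebra.Bundles using (CommutativeRing)
open import Data.Bool using (Bool; true; false; if_then_else_; _∧_; _∨_; not)
open import Data.Nat using (ℕ; zero; suc; _+_; _∸_; _≡ᵇ_; _<ᵇ_)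
open import Data.Product using (_×_; _,_; proj₁; proj₂)
open import Data.List using (List; []; _∷_; map; concatMap; upTo; applyUpTo; length; filterᵇ; _++_)
open import Data.Bool.ListAction using (any; all)
open import Data.Nat.ListAction using (sum)
open import Data.Vec using (Vec; []; _∷_; init; last)

range0 : ℕ → List ℕ
range0 n = upTo (suc n)

countᵇ : {a : Level} {A : Set a} → (A → Bool) → List A → ℕ
countᵇ p []       = 0
countᵇ p (x ∷ xs) = if p x then suc (countᵇ p xs) else countᵇ p xs

_≤ᵇ'_ : ℕ → ℕ → Bool
m ≤ᵇ' n = m <ᵇ suc n

decreasingᵇ : List ℕ → Bool
decreasingᵇ []           = true
decreasingᵇ (x ∷ [])     = true
decreasingᵇ (x ∷ y ∷ xs) = (y ≤ᵇ' x) ∧ decreasingᵇ (y ∷ xs)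

allZeroᵇ : List ℕ → Bool
allZeroᵇ = all (λ x → x ≡ᵇ 0)

eqListᵇ : List ℕ → List ℕ → Bool
eqListᵇ []       []       = true
eqListᵇ (x ∷ xs) (y ∷ ys) = (x ≡ᵇ y) ∧ eqListᵇ xs ys
eqListᵇ _        _        = false

boxes : List ℕ → List (List ℕ)
boxes []       = [] ∷ []
boxes (l ∷ ls) = concatMap (λ i → map (i ∷_) (boxes ls)) (range0 l)

allVecs : ℕ → ℕ → List (List ℕ)
allVecs zero    B = [] ∷ []
allVecs (suc L) B = concatMap (λ i → map (i ∷_) (allVecs L B)) (range0 B)

-- sub-partitions μ ⊆ λ, written as lists of the same length as λ
-- (padded with zeros)
subPartitions : List ℕ → List (List ℕ)
subPartitions λ′ = filterᵇ decreasingᵇ (boxes λ′)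

-- cells (i , j) of the skew diagram λ/μ: row i (0-based), column j (1-based),
-- μᵢ < j ≤ λᵢ
cellsFrom : ℕ → List ℕ → List ℕ → List (ℕ × ℕ)
cellsFrom i (l ∷ ls) (m ∷ ms) =
  applyUpTo (λ t → (i , suc (m + t))) (l ∸ m) ++ cellsFrom (suc i) ls ms
cellsFrom i _ _ = []

cells : List ℕ → List ℕ → List (ℕ × ℕ)
cells λ′ μ = cellsFrom 0 λ′ μ

adjᵇ : ℕ × ℕ → ℕ × ℕ → Bool
adjᵇ (i , j) (i′ , j′) =
  ((i ≡ᵇ i′) ∧ ((j′ ≡ᵇ suc j) ∨ (j ≡ᵇ suc j′)))
  ∨ ((j ≡ᵇ j′) ∧ ((i′ ≡ᵇ suc i) ∨ (i ≡ᵇ suc i′)))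

eqCellᵇ : ℕ × ℕ → ℕ × ℕ → Bool
eqCellᵇ (i , j) (i′ , j′) = (i ≡ᵇ i′) ∧ (j ≡ᵇ j′)

reachᵇ : List (ℕ × ℕ) → ℕ → ℕ × ℕ → ℕ × ℕ → Bool
reachᵇ cs zero    s t = eqCellᵇ s t
reachᵇ cs (suc m) s t =
  reachᵇ cs m s t ∨ any (λ u → adjᵇ s u ∧ reachᵇ cs m u t) cs

connectedᵇ : List (ℕ × ℕ) → ℕ × ℕ → ℕ × ℕ → Bool
connectedᵇ cs s t = reachᵇ cs (length cs) s t

-- number of connected components: count the cells not connected to any
-- earlier cell (each component counted once, by its first cell)
componentsFrom : List (ℕ × ℕ) → List (ℕ × ℕ) → List (ℕ × ℕ) → ℕ
componentsFrom cs earlier []       = 0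
componentsFrom cs earlier (p ∷ ps) =
  (if any (λ q → connectedᵇ cs q p) earlier then 0 else 1)
  + componentsFrom cs (p ∷ earlier) ps

rowsNE : List ℕ → List ℕ → ℕ
rowsNE λ′ μ = countᵇ (λ i → any (λ p → proj₁ p ≡ᵇ i) (cells λ′ μ)) (upTo (length λ′))

colsNE : List ℕ → List ℕ → ℕ
colsNE λ′ μ = countᵇ (λ j → any (λ p → proj₂ p ≡ᵇ j) (cells λ′ μ)) (applyUpTo suc (sum λ′))

compsNE : List ℕ → List ℕ → ℕ
compsNE λ′ μ = componentsFrom (cells λ′ μ) [] (cells λ′ μ)

mult : List ℕ → ℕ → ℕ
mult λ′ j = countᵇ (λ p → p ≡ᵇ j) λ′

topBoundary : List ℕ → ℕ → List ℕ
topBoundary λ′ L = applyUpTo (λ t → mult λ′ (suc t)) L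

module _ {c ℓ : Level} (R : CommutativeRing c ℓ) where
  open CommutativeRing R using (Carrier; 0#; 1#) renaming (_+_ to _⊕_; _*_ to _⊗_)

  pow : Carrier → ℕ → Carrier
  pow x zero    = 1#
  pow x (suc k) = x ⊗ pow x k

  Σ : {a : Level} {A : Set a} → (A → Carrier) → List A → Carrier
  Σ f []       = 0#
  Σ f (x ∷ xs) = f x ⊕ Σ f xs

  gSkew : Carrier → Carrier → Carrier → List ℕ → List ℕ → Carrier
  gSkew α β x λ′ μ =
    let r = rowsNE λ′ μ ; cc = colsNE λ′ μ ; b = compsNE λ′ μ in
    pow β (r ∸ b) ⊗ pow (α ⊕ β) ((sum λ′ ∸ sum μ + b) ∸ (r + cc))
      ⊗ pow x b ⊗ pow (α ⊕ x) (cc ∸ b)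

  gPoly : Carrier → Carrier → {n : ℕ} → Vec Carrier n → List ℕ → Carrier
  gPoly α β {zero}  xs λ′ = if allZeroᵇ λ′ then 1# else 0#
  gPoly α β {suc n} xs λ′ =
    Σ (λ μ → gPoly α β (init xs) μ ⊗ gSkew α β (last xs) λ′ μ) (subPartitions λ′)

  weight : Carrier → Carrier → Carrier → ℕ → ℕ → ℕ → ℕ → Carrier
  weight α β x a b c′ d =
    if (a + b) ≡ᵇ (c′ + d)
    then (if d <ᵇ a
          then pow (α ⊕ β) (a ∸ d ∸ 1) ⊗ (x ⊕ α) ⊗ pow β d
          else (if 0 <ᵇ a then pow β (a ∸ 1) ⊗ x else 1#))
    else 0#

  -- One row with parameter x, sites 1..L, horizontal labels in [0..B]:
  -- rowFrom … a bs ds = sum over the horizontal labels to the right of a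
  -- left label a, with bottom labels bs and top labels ds, right boundary 0.
  rowFrom : Carrier → Carrier → ℕ → Carrier → ℕ → List ℕ → List ℕ → Carrier
  rowFrom α β B x a []       []       = if a ≡ᵇ 0 then 1# else 0#
  rowFrom α β B x a (b ∷ bs) (d ∷ ds) =
    Σ (λ c′ → weight α β x a b c′ d ⊗ rowFrom α β B x c′ bs ds) (range0 B)
  rowFrom α β B x a _        _        = 0#

  rowPF : Carrier → Carrier → ℕ → Carrier → List ℕ → List ℕ → Carrier
  rowPF α β B x bs ds = Σ (λ a → rowFrom α β B x a bs ds) (range0 B)

  -- Partition function of the rows with parameters xs (bottom to top),
  -- width L, all labels in [0..B], bottom labels bs, top labels top.
  latticePF : Carrier → Carrier → ℕ → ℕ → {n : ℕ} → Vec Carrier (suc n)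
              → List ℕ → List ℕ → Carrier
  latticePF α β L B (x ∷ [])     bs top = rowPF α β B x bs top
  latticePF α β L B (x ∷ y ∷ xs) bs top =
    Σ (λ ds → rowPF α β B x bs ds ⊗ latticePF α β L B (y ∷ xs) ds top) (allVecs L B)

open import Data.List.Relation.Unary.All using (All)
open import Data.List.Relation.Unary.Linked using (Linked)
open import Data.Nat using (_≤_; _<_; _≥_)

IsPartition : List ℕ → Set
IsPartition λ′ = Linked _≥_ λ′ × All (0 <_) λ′

-- The lattice is a transfer-matrix form of the branching rule g_λ = Σ_μ g_μ · g_{λ/μ}: the labels between
-- two rows are the multiplicities (mⱼ(μ)) of a partition μ, and one row with parameter x, bottom (mⱼ(μ))
-- and top (mⱼ(λ)) has partition function g_{λ/μ}(x).  That row vanishes unless μ ⊆ λ, and then conservation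
-- forces the horizontal label entering column j to be the height hⱼ of column j of λ/μ.  Each vertex weight
-- is a monomial in α+β, α+x, β and x whose exponents, summed over the columns, give the statistics of λ/μ:
-- |λ/μ| = Σ hⱼ, r = Σ min(hⱼ, mⱼ(λ)), c = #{j : hⱼ > 0} and b = #{j : 0 < hⱼ ≤ mⱼ(λ)}, the columns
-- ending a component; on the diagram side components start at the rows that do not overlap the row above.

module Submission where

open import Algebra.Bundles using (CommutativeRing)
open import Data.Bool using (Bool; true; false; if_then_else_; _∧_; _∨_; T?)
open import Data.Bool.ListAction using (any)
open import Data.Bool.Properties using (∧-zeroʳ; ∧-identityʳ; ∨-zeroʳ; T-≡)
open import Data.Empty using (⊥-elim)
open import Data.List using (List; []; _∷_; length; _++_; applyUpTo; map; concatMap; replicate; drop; filterᵇ)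
open import Data.List.Membership.Propositional using (_∈_; find)
open import Data.List.Membership.Propositional.Properties
  using ( ∈-applyUpTo⁺; ∈-applyUpTo⁻; ∈-++⁺ˡ; ∈-++⁺ʳ; ∈-++⁻; ∈-map⁺; ∈-map⁻; ∈-concatMap⁺; ∈-concatMap⁻
        ; ∈-upTo⁺; ∈-upTo⁻; ∈-filter⁺; ∈-filter⁻)
open import Data.List.Properties using (length-++; length-applyUpTo; length-replicate)
open import Data.List.Relation.Binary.Pointwise as Pointwise using (Pointwise; []; _∷_; Pointwise-length; Pointwise-≡⇒≡)
open import Data.List.Relation.Unary.All as All using (All; []; _∷_)
import Data.List.Relation.Unary.All.Properties as Allₚ
open import Data.List.Relation.Unary.AllPairs using (AllPairs; []; _∷_)
import Data.List.Relation.Unary.AllPairs.Properties as AllPairsₚ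
open import Data.List.Relation.Unary.Any as Any using (here; there)
open import Data.List.Relation.Unary.Any.Properties using (any⁺; any⁻)
open import Data.List.Relation.Unary.Linked.Properties using (Linked⇒AllPairs)
open import Data.Nat
open import Data.Nat.ListAction using (sum)
open import Data.Nat.Properties
open import Data.Nat.Tactic.RingSolver using (solve-∀)
open import Data.Product using (_×_; _,_; proj₁; proj₂; ∃; Σ-syntax)
open import Data.Sum using (_⊎_; inj₁; inj₂)
open import Data.Vec using (Vec; []; _∷_; init; last)
open import Function.Bundles using (Equivalence)
open import Relation.Binary using (tri<; tri≈; tri>)
open import Relation.Binary.PropositionalEquality
  using (_≡_; _≢_; refl; sym; trans; cong; cong₂; subst; subst₂; module ≡-Reasoning)
open import Relation.Nullary using (¬_; yes; no)
open import Algebra.Properties.CommutativeSemigroup +-commutativeSemigroup using (interchange)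

open import Defs hiding (Σ)

ind : Bool → ℕ
ind true  = 1
ind false = 0

ind≤1 : ∀ b → ind b ≤ 1
ind≤1 true  = ≤-refl
ind≤1 false = z≤n

<ᵇ-true : ∀ {m n} → m < n → (m <ᵇ n) ≡ true
<ᵇ-true m<n = Equivalence.to T-≡ (<⇒<ᵇ m<n)

<ᵇ-false : ∀ {m n} → n ≤ m → (m <ᵇ n) ≡ false
<ᵇ-false {m}     {zero}  _       = refl
<ᵇ-false {suc m} {suc n} (s≤s p) = <ᵇ-false p

≡ᵇ-refl : ∀ n → (n ≡ᵇ n) ≡ true
≡ᵇ-refl n = Equivalence.to T-≡ (≡⇒≡ᵇ n n refl)

≡ᵇ-false : ∀ {m n} → m ≢ n → (m ≡ᵇ n) ≡ false
≡ᵇ-false {zero}  {zero}  p = ⊥-elim (p refl)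
≡ᵇ-false {zero}  {suc n} p = refl
≡ᵇ-false {suc m} {zero}  p = refl
≡ᵇ-false {suc m} {suc n} p = ≡ᵇ-false (λ e → p (cong suc e))

≡ᵇ-true⇒≡ : ∀ m n → (m ≡ᵇ n) ≡ true → m ≡ n
≡ᵇ-true⇒≡ m n e = ≡ᵇ⇒≡ m n (Equivalence.from T-≡ e)

<ᵇ-true⇒< : ∀ m n → (m <ᵇ n) ≡ true → m < n
<ᵇ-true⇒< m n e = <ᵇ⇒< m n (Equivalence.from T-≡ e)

<ᵇ-false⇒≥ : ∀ m n → (m <ᵇ n) ≡ false → n ≤ m
<ᵇ-false⇒≥ m       zero    _ = z≤n
<ᵇ-false⇒≥ (suc m) (suc n) e = s≤s (<ᵇ-false⇒≥ m n e)

≡ᵇ-sym : ∀ m n → (m ≡ᵇ n) ≡ (n ≡ᵇ m)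
≡ᵇ-sym zero    zero    = refl
≡ᵇ-sym zero    (suc n) = refl
≡ᵇ-sym (suc m) zero    = refl
≡ᵇ-sym (suc m) (suc n) = ≡ᵇ-sym m n

sumFrom : (ℕ → ℕ) → ℕ → ℕ → ℕ
sumFrom f k zero    = 0
sumFrom f k (suc n) = f k + sumFrom f (suc k) n

sumFrom-cong : ∀ {f g : ℕ → ℕ} → (∀ j → f j ≡ g j) → ∀ k n → sumFrom f k n ≡ sumFrom g k n
sumFrom-cong e k zero    = refl
sumFrom-cong e k (suc n) = cong₂ _+_ (e k) (sumFrom-cong e (suc k) n)

sumFrom-+ : ∀ (f g : ℕ → ℕ) k n → sumFrom (λ j → f j + g j) k n ≡ sumFrom f k n + sumFrom g k n
sumFrom-+ f g k zero    = refl
sumFrom-+ f g k (suc n) =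
  trans (cong (f k + g k +_) (sumFrom-+ f g (suc k) n))
        (interchange (f k) (g k) (sumFrom f (suc k) n) (sumFrom g (suc k) n))

sumFrom-zero : ∀ {f : ℕ → ℕ} → (∀ j → f j ≡ 0) → ∀ k n → sumFrom f k n ≡ 0
sumFrom-zero e k zero    = refl
sumFrom-zero e k (suc n) rewrite e k = sumFrom-zero e (suc k) n

sumFrom-snoc : ∀ (f : ℕ → ℕ) k n → sumFrom f k (suc n) ≡ sumFrom f k n + f (k + n)
sumFrom-snoc f k zero    rewrite +-identityʳ k = +-comm (f k) 0
sumFrom-snoc f k (suc n) rewrite sumFrom-snoc f (suc k) n | +-suc k n = sym (+-assoc (f k) _ _)

sumFrom-suc : ∀ (f : ℕ → ℕ) k n → sumFrom f (suc k) n ≡ sumFrom (λ j → f (suc j)) k n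
sumFrom-suc f k zero    = refl
sumFrom-suc f k (suc n) = cong (f (suc k) +_) (sumFrom-suc f (suc k) n)

sumFrom-congᵢ : ∀ {f g : ℕ → ℕ} k n → (∀ j → k ≤ j → j < k + n → f j ≡ g j) →
                sumFrom f k n ≡ sumFrom g k n
sumFrom-congᵢ k zero    _ = refl
sumFrom-congᵢ k (suc n) e rewrite +-suc k n =
  cong₂ _+_ (e k ≤-refl (s≤s (m≤m+n k n)))
            (sumFrom-congᵢ (suc k) n (λ j k<j j< → e j (<⇒≤ k<j) j<))

sumFrom-point< : ∀ p k n → p < k → sumFrom (λ j → ind (j ≡ᵇ p)) k n ≡ 0
sumFrom-point< p k zero    _   = refl
sumFrom-point< p k (suc n) p<k rewrite ≡ᵇ-false {k} {p} (λ e → <⇒≢ p<k (sym e)) =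
  sumFrom-point< p (suc k) n (≤-trans p<k (n≤1+n k))

sumFrom-point : ∀ p k n → k ≤ p → p < k + n → sumFrom (λ j → ind (j ≡ᵇ p)) k n ≡ 1
sumFrom-point p k zero    k≤p p< = ⊥-elim (<⇒≱ p< (subst (_≤ p) (sym (+-identityʳ k)) k≤p))
sumFrom-point p k (suc n) k≤p p< with k ≟ p
... | yes refl rewrite ≡ᵇ-refl k = cong suc (sumFrom-point< k (suc k) n (n<1+n k))
... | no k≢p   rewrite ≡ᵇ-false k≢p =
  sumFrom-point p (suc k) n (≤∧≢⇒< k≤p k≢p) (subst (p <_) (+-suc k n) p<)

sumFrom-point′ : ∀ p n b → (b ≡ true → 1 ≤ p × p ≤ n) →
                 sumFrom (λ j → ind ((p ≡ᵇ j) ∧ b)) 1 n ≡ ind b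
sumFrom-point′ p n false _ = sumFrom-zero (λ j → cong ind (∧-zeroʳ (p ≡ᵇ j))) 1 n
sumFrom-point′ p n true  h = begin
  sumFrom (λ j → ind ((p ≡ᵇ j) ∧ true)) 1 n ≡⟨ sumFrom-cong (λ j → cong ind (trans (∧-identityʳ _) (≡ᵇ-sym p j))) 1 n ⟩
  sumFrom (λ j → ind (j ≡ᵇ p)) 1 n         ≡⟨ sumFrom-point p 1 n (proj₁ (h refl)) (s≤s (proj₂ (h refl))) ⟩
  1                                        ∎
  where open ≡-Reasoning

sumFrom-≤ : ∀ l n → sumFrom (λ j → ind (j <ᵇ suc l)) 1 n ≡ n ⊓ l
sumFrom-≤ l zero    = refl
sumFrom-≤ l (suc n) rewrite sumFrom-snoc (λ j → ind (j <ᵇ suc l)) 1 n | sumFrom-≤ l n with <-cmp n l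
... | tri< n<l _ _   rewrite <ᵇ-true {suc n} {suc l} (s≤s n<l) | m≤n⇒m⊓n≡m (<⇒≤ n<l) | m≤n⇒m⊓n≡m n<l = +-comm n 1
... | tri≈ _ refl _ rewrite <ᵇ-false {suc n} {suc n} ≤-refl | m≤n⇒m⊓n≡m (≤-refl {n}) | m≥n⇒m⊓n≡n (n≤1+n n) = +-identityʳ n
... | tri> _ _ l<n   rewrite <ᵇ-false {suc n} {suc l} (s≤s (<⇒≤ l<n)) | m≥n⇒m⊓n≡n (<⇒≤ l<n)
                           | m≥n⇒m⊓n≡n (≤-trans (<⇒≤ l<n) (n≤1+n n)) = +-identityʳ l

interval-split : ∀ m l j → m ≤ l → ind ((m <ᵇ j) ∧ (j <ᵇ suc l)) + ind (j <ᵇ suc m) ≡ ind (j <ᵇ suc l)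
interval-split m l j m≤l with <-cmp m j
... | tri< m<j _ _   rewrite <ᵇ-true m<j | <ᵇ-false {j} {suc m} m<j = +-identityʳ _
... | tri≈ _ refl _ rewrite <ᵇ-false {m} {m} ≤-refl | <ᵇ-true (n<1+n m) | <ᵇ-true {m} {suc l} (s≤s m≤l) = refl
... | tri> _ _ j<m   rewrite <ᵇ-false {m} {j} (<⇒≤ j<m) | <ᵇ-true (≤-trans j<m (n≤1+n m))
                           | <ᵇ-true (≤-trans j<m (≤-trans m≤l (n≤1+n l))) = refl

sumFrom-interval : ∀ m l n → m ≤ l → l ≤ n → sumFrom (λ j → ind ((m <ᵇ j) ∧ (j <ᵇ suc l))) 1 n ≡ l ∸ m
sumFrom-interval m l n m≤l l≤n = +-cancelʳ-≡ m _ _ (trans eq (sym (m∸n+n≡m m≤l)))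
  where
  open ≡-Reasoning
  I = λ j → ind ((m <ᵇ j) ∧ (j <ᵇ suc l))
  eq : sumFrom I 1 n + m ≡ l
  eq = begin
    sumFrom I 1 n + m
      ≡⟨ cong (sumFrom I 1 n +_) (sym (trans (sumFrom-≤ m n) (m≥n⇒m⊓n≡n (≤-trans m≤l l≤n)))) ⟩
    sumFrom I 1 n + sumFrom (λ j → ind (j <ᵇ suc m)) 1 n ≡⟨ sym (sumFrom-+ _ _ 1 n) ⟩
    sumFrom (λ j → I j + ind (j <ᵇ suc m)) 1 n          ≡⟨ sumFrom-cong (λ j → interval-split m l j m≤l) 1 n ⟩
    sumFrom (λ j → ind (j <ᵇ suc l)) 1 n                ≡⟨ trans (sumFrom-≤ l n) (m≥n⇒m⊓n≡n l≤n) ⟩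
    l                                                   ∎

-- Skew shapes and their column heights

data Skew : List ℕ → List ℕ → Set where
  []   : Skew [] []
  cons : ∀ {l m ls ms} → m ≤ l → All (_≤ l) ls → All (_≤ m) ms → Skew ls ms → Skew (l ∷ ls) (m ∷ ms)

height : List ℕ → List ℕ → ℕ → ℕ
height (l ∷ ls) (m ∷ ms) j = ind ((m <ᵇ j) ∧ (j <ᵇ suc l)) + height ls ms j
height _        _        j = 0

head₀ : List ℕ → ℕ
head₀ []      = 0
head₀ (x ∷ _) = x

head₀≤ : ∀ {ls l} → All (_≤ l) ls → head₀ ls ≤ l
head₀≤ []      = z≤n
head₀≤ (p ∷ _) = p

-- A nonempty column j is the rightmost column of its component iff each of its cells ends its row of λ,
-- i.e. 0 < height j ≤ mⱼ(λ); so b(λ/μ) is the number of such columns.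
endsComponent : ℕ → ℕ → ℕ
endsComponent a d = ind ((0 <ᵇ a) ∧ (a <ᵇ suc d))

mult-cons : ∀ l ls j → mult (l ∷ ls) j ≡ ind (l ≡ᵇ j) + mult ls j
mult-cons l ls j with l ≡ᵇ j
... | true  = refl
... | false = refl

mult≤height : ∀ {ls ms m j} → Skew ls ms → All (_≤ m) ms → m < j → mult ls j ≤ height ls ms j
mult≤height [] _ _ = z≤n
mult≤height {l ∷ ls} {m′ ∷ ms} {m} {j} (cons _ _ _ s) (m′≤m ∷ bs) m<j rewrite mult-cons l ls j with l ≟ j
... | yes refl rewrite ≡ᵇ-refl l | <ᵇ-true (≤-<-trans m′≤m m<j) | <ᵇ-true (n<1+n l) = s≤s (mult≤height s bs m<j)
... | no l≢j   rewrite ≡ᵇ-false l≢j = ≤-trans (mult≤height s bs m<j) (m≤n+m _ _)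

height≤mult : ∀ {ls ms j} → Skew ls ms → All (_≤ j) ls → height ls ms j ≤ mult ls j
height≤mult [] _ = z≤n
height≤mult {l ∷ ls} {m′ ∷ ms} {j} (cons _ _ _ s) (l≤j ∷ bs) rewrite mult-cons l ls j with l ≟ j
... | yes refl rewrite ≡ᵇ-refl l = +-mono-≤ (ind≤1 ((m′ <ᵇ l) ∧ (l <ᵇ suc l))) (height≤mult s bs)
... | no l≢j   rewrite ≡ᵇ-false l≢j | <ᵇ-false {j} {suc l} (≤∧≢⇒< l≤j l≢j) | ∧-zeroʳ (m′ <ᵇ j) = height≤mult s bs

height-beyond : ∀ {ls ms j} → All (_< j) ls → height ls ms j ≡ 0
height-beyond {[]}              _          = refl
height-beyond {l ∷ ls} {[]}     _          = refl
height-beyond {l ∷ ls} {m ∷ ms} {j} (l<j ∷ bs) rewrite <ᵇ-false {j} {suc l} l<j | ∧-zeroʳ (m <ᵇ j) = height-beyond bs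

mult-beyond : ∀ {ls j} → All (_< j) ls → mult ls j ≡ 0
mult-beyond {[]}               _          = refl
mult-beyond {l ∷ ls} {j} (l<j ∷ bs) rewrite mult-cons l ls j | ≡ᵇ-false {l} {j} (<⇒≢ l<j) = mult-beyond bs

height≤length : ∀ ls ms j → height ls ms j ≤ length ls
height≤length (l ∷ ls) (m ∷ ms) j = +-mono-≤ (ind≤1 ((m <ᵇ j) ∧ (j <ᵇ suc l))) (height≤length ls ms j)
height≤length []       ms       j = z≤n
height≤length (l ∷ ls) []       j = z≤n

endsComponent-≤ : ∀ {a d} → 0 < a → a ≤ d → endsComponent a d ≡ 1
endsComponent-≤ p q rewrite <ᵇ-true p | <ᵇ-true (s≤s q) = refl

endsComponent-> : ∀ {a d} → d < a → endsComponent a d ≡ 0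
endsComponent-> {a} {d} p rewrite <ᵇ-false {a} {suc d} p = cong ind (∧-zeroʳ (0 <ᵇ a))

endsComponent-suc : ∀ {a d} → a ≤ d → endsComponent a (suc d) ≡ endsComponent a d
endsComponent-suc {zero}  _ = refl
endsComponent-suc {suc a} p rewrite <ᵇ-true (s≤s p) | <ᵇ-true (s≤s (m≤n⇒m≤1+n p)) = refl

endsComponent-height : ∀ {ls ms m j} → Skew ls ms → All (_≤ m) ms → m < j →
                       endsComponent (height ls ms j) (mult ls j) ≡ ind (head₀ ls ≡ᵇ j)
endsComponent-height {[]} {[]} {m} {j} [] _ m<j rewrite ≡ᵇ-false {0} {j} (<⇒≢ (≤-<-trans z≤n m<j)) = refl
endsComponent-height {l ∷ ls} {m′ ∷ ms} {m} {j} (cons m′≤l ls≤l ms≤m′ s) (m′≤m ∷ _) m<j with <-cmp j l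
... | tri≈ _ refl _ rewrite mult-cons l ls l | ≡ᵇ-refl l | <ᵇ-true (≤-<-trans m′≤m m<j) | <ᵇ-true (n<1+n l) =
  endsComponent-≤ (s≤s z≤n) (s≤s (height≤mult s ls≤l))
... | tri> _ _ l<j rewrite height-beyond {l ∷ ls} {m′ ∷ ms} (l<j ∷ All.map (λ p → ≤-<-trans p l<j) ls≤l)
                         | ≡ᵇ-false {l} {j} (<⇒≢ l<j) = refl
... | tri< j<l _ _ rewrite mult-cons l ls j | ≡ᵇ-false {l} {j} (λ e → <⇒≢ j<l (sym e))
                         | <ᵇ-true (≤-<-trans m′≤m m<j) | <ᵇ-true (m≤n⇒m≤1+n j<l) =
  endsComponent-> (s≤s (mult≤height s ms≤m′ (≤-<-trans m′≤m m<j)))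

height⊓mult-cons : ∀ {l m ls ms} → Skew (l ∷ ls) (m ∷ ms) → ∀ j →
  height (l ∷ ls) (m ∷ ms) j ⊓ mult (l ∷ ls) j ≡ height ls ms j ⊓ mult ls j + ind ((l ≡ᵇ j) ∧ (m <ᵇ l))
height⊓mult-cons {l} {m} {ls} {ms} (cons m≤l ls≤l ms≤m s) j rewrite mult-cons l ls j with <-cmp m j
... | tri< m<j _ _ with <-cmp j l
...   | tri< j<l _ _ rewrite <ᵇ-true m<j | <ᵇ-true (m≤n⇒m≤1+n j<l) | ≡ᵇ-false {l} {j} (λ e → <⇒≢ j<l (sym e))
                           | m≥n⇒m⊓n≡n (m≤n⇒m≤1+n (mult≤height s ms≤m m<j)) | m≥n⇒m⊓n≡n (mult≤height s ms≤m m<j)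
                           | +-identityʳ (mult ls j) = refl
...   | tri≈ _ refl _ rewrite <ᵇ-true m<j | <ᵇ-true (n<1+n l) | ≡ᵇ-refl l = +-comm 1 _
...   | tri> _ _ l<j rewrite height-beyond {ls} {ms} (All.map (λ p → ≤-<-trans p l<j) ls≤l)
                           | mult-beyond (All.map (λ p → ≤-<-trans p l<j) ls≤l)
                           | <ᵇ-false {j} {suc l} l<j | ≡ᵇ-false {l} {j} (<⇒≢ l<j) | ∧-zeroʳ (m <ᵇ j) = refl
height⊓mult-cons {l} {m} {ls} {ms} (cons m≤l ls≤l ms≤m s) j | tri≈ _ refl _ rewrite <ᵇ-false {j} {j} ≤-refl with l ≟ j
... | no l≢j   rewrite ≡ᵇ-false l≢j | +-identityʳ (height ls ms j ⊓ mult ls j) = refl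
... | yes refl rewrite ≡ᵇ-refl l | <ᵇ-false {l} {l} ≤-refl | m≤n⇒m⊓n≡m (m≤n⇒m≤1+n (height≤mult s ls≤l))
                     | m≤n⇒m⊓n≡m (height≤mult s ls≤l) | +-identityʳ (height ls ms l) = refl
height⊓mult-cons {l} {m} {ls} {ms} (cons m≤l ls≤l ms≤m s) j | tri> _ _ j<m rewrite <ᵇ-false {m} {j} (<⇒≤ j<m) with l ≟ j
... | no l≢j   rewrite ≡ᵇ-false l≢j | +-identityʳ (height ls ms j ⊓ mult ls j) = refl
... | yes refl = ⊥-elim (<⇒≱ j<m m≤l)

≡ᵇ∧<ᵇ-of-≤ : ∀ {h j m} → j ≤ m → ((h ≡ᵇ j) ∧ (m <ᵇ h)) ≡ false
≡ᵇ∧<ᵇ-of-≤ {h} {j} j≤m with h ≟ j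
... | yes refl rewrite <ᵇ-false j≤m = ∧-zeroʳ (h ≡ᵇ h)
... | no h≢j   rewrite ≡ᵇ-false h≢j = refl

≡ᵇ∧<ᵇ-of-> : ∀ {h j m} → m < j → ((h ≡ᵇ j) ∧ (m <ᵇ h)) ≡ (h ≡ᵇ j)
≡ᵇ∧<ᵇ-of-> {h} {j} m<j with h ≟ j
... | yes refl rewrite <ᵇ-true m<j | ≡ᵇ-refl h = refl
... | no h≢j   rewrite ≡ᵇ-false h≢j = refl

endsComponent-cons : ∀ {l m ls ms} → Skew (l ∷ ls) (m ∷ ms) → ∀ j →
  endsComponent (height (l ∷ ls) (m ∷ ms) j) (mult (l ∷ ls) j) + ind ((head₀ ls ≡ᵇ j) ∧ (m <ᵇ head₀ ls))
    ≡ endsComponent (height ls ms j) (mult ls j) + ind ((l ≡ᵇ j) ∧ (m <ᵇ l))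
endsComponent-cons {l} {m} {ls} {ms} (cons m≤l ls≤l ms≤m s) j rewrite mult-cons l ls j with <-cmp m j
... | tri< m<j _ _ rewrite ≡ᵇ∧<ᵇ-of-> {head₀ ls} m<j | endsComponent-height s ms≤m m<j with <-cmp j l
...   | tri< j<l _ _ rewrite <ᵇ-true m<j | <ᵇ-true (m≤n⇒m≤1+n j<l) | ≡ᵇ-false {l} {j} (λ e → <⇒≢ j<l (sym e))
                           | endsComponent-> {suc (height ls ms j)} {mult ls j} (s≤s (mult≤height s ms≤m m<j)) = +-comm 0 _
...   | tri≈ _ refl _ rewrite <ᵇ-true m<j | <ᵇ-true (n<1+n l) | ≡ᵇ-refl l
                           | endsComponent-≤ {suc (height ls ms j)} {suc (mult ls j)} (s≤s z≤n) (s≤s (height≤mult s ls≤l)) = +-comm 1 _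
...   | tri> _ _ l<j rewrite height-beyond {ls} {ms} (All.map (λ p → ≤-<-trans p l<j) ls≤l)
                           | mult-beyond (All.map (λ p → ≤-<-trans p l<j) ls≤l)
                           | <ᵇ-false {j} {suc l} l<j | ≡ᵇ-false {l} {j} (<⇒≢ l<j)
                           | ≡ᵇ-false {head₀ ls} {j} (<⇒≢ (≤-<-trans (head₀≤ ls≤l) l<j)) | ∧-zeroʳ (m <ᵇ j) = refl
endsComponent-cons {l} {m} {ls} {ms} (cons m≤l ls≤l ms≤m s) j | tri≈ _ refl _
  rewrite ≡ᵇ∧<ᵇ-of-≤ {head₀ ls} {j} {m} ≤-refl | <ᵇ-false {j} {j} ≤-refl with l ≟ j
... | no l≢j   rewrite ≡ᵇ-false l≢j = refl
... | yes refl rewrite ≡ᵇ-refl l | <ᵇ-false {l} {l} ≤-refl | endsComponent-suc {height ls ms l} {mult ls l} (height≤mult s ls≤l) = refl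
endsComponent-cons {l} {m} {ls} {ms} (cons m≤l ls≤l ms≤m s) j | tri> _ _ j<m
  rewrite ≡ᵇ∧<ᵇ-of-≤ {head₀ ls} {j} {m} (<⇒≤ j<m) | <ᵇ-false {m} {j} (<⇒≤ j<m) with l ≟ j
... | no l≢j   rewrite ≡ᵇ-false l≢j = refl
... | yes refl = ⊥-elim (<⇒≱ j<m m≤l)

nonemptyRows : List ℕ → List ℕ → ℕ
nonemptyRows (l ∷ ls) (m ∷ ms) = ind (m <ᵇ l) + nonemptyRows ls ms
nonemptyRows _        _        = 0

-- Row i starts a new component iff it is nonempty and does not overlap
-- row i - 1, i.e. λᵢ ≤ μᵢ₋₁; p carries μᵢ₋₁.
newComponentsBelow : ℕ → List ℕ → List ℕ → ℕ
newComponentsBelow p (l ∷ ls) (m ∷ ms) = ind ((m <ᵇ l) ∧ (l <ᵇ suc p)) + newComponentsBelow m ls ms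
newComponentsBelow p _        _        = 0

newComponents : List ℕ → List ℕ → ℕ
newComponents (l ∷ ls) (m ∷ ms) = ind (m <ᵇ l) + newComponentsBelow m ls ms
newComponents _        _        = 0

nonempty⇒bounded : ∀ {m l n} → l ≤ n → (m <ᵇ l) ≡ true → 1 ≤ l × l ≤ n
nonempty⇒bounded {m} {l} l≤n e = ≤-trans (s≤s z≤n) (<ᵇ-true⇒< m l e) , l≤n

nonemptyRows≡sum-height⊓mult : ∀ {Λ μ n} → Skew Λ μ → All (_≤ n) Λ →
  nonemptyRows Λ μ ≡ sumFrom (λ j → height Λ μ j ⊓ mult Λ j) 1 n
nonemptyRows≡sum-height⊓mult {n = n} [] _ = sym (sumFrom-zero (λ j → refl) 1 n)
nonemptyRows≡sum-height⊓mult {l ∷ ls} {m ∷ ms} {n} s@(cons _ _ _ s′) (l≤n ∷ bs) = begin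
  ind (m <ᵇ l) + nonemptyRows ls ms       ≡⟨ cong (ind (m <ᵇ l) +_) (nonemptyRows≡sum-height⊓mult s′ bs) ⟩
  ind (m <ᵇ l) + sumFrom F 1 n            ≡⟨ +-comm (ind (m <ᵇ l)) _ ⟩
  sumFrom F 1 n + ind (m <ᵇ l)            ≡⟨ cong (sumFrom F 1 n +_) (sym (sumFrom-point′ l n _ (nonempty⇒bounded l≤n))) ⟩
  sumFrom F 1 n + sumFrom (λ j → ind ((l ≡ᵇ j) ∧ (m <ᵇ l))) 1 n ≡⟨ sym (sumFrom-+ _ _ 1 n) ⟩
  sumFrom (λ j → F j + ind ((l ≡ᵇ j) ∧ (m <ᵇ l))) 1 n           ≡⟨ sumFrom-cong (λ j → sym (height⊓mult-cons s j)) 1 n ⟩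
  sumFrom (λ j → height (l ∷ ls) (m ∷ ms) j ⊓ mult (l ∷ ls) j) 1 n ∎
  where
  open ≡-Reasoning
  F = λ j → height ls ms j ⊓ mult ls j

newComponentsBelow-head : ∀ {p ls ms} → Skew ls ms → All (_≤ p) ms →
  newComponentsBelow p ls ms + ind (p <ᵇ head₀ ls) ≡ newComponents ls ms
newComponentsBelow-head [] _ = refl
newComponentsBelow-head {p} {l ∷ ls} {m ∷ ms} (cons m≤l _ _ _) (m≤p ∷ _) with <-cmp p l
... | tri< p<l _ _   rewrite <ᵇ-true p<l | <ᵇ-true (≤-<-trans m≤p p<l) | <ᵇ-false {l} {suc p} p<l = +-comm _ 1
... | tri≈ _ refl _ rewrite <ᵇ-false {p} {p} ≤-refl | <ᵇ-true (n<1+n p) | ∧-identityʳ (m <ᵇ p) = +-identityʳ _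
... | tri> _ _ l<p   rewrite <ᵇ-false {p} {l} (<⇒≤ l<p) | <ᵇ-true (m≤n⇒m≤1+n l<p) | ∧-identityʳ (m <ᵇ l) = +-identityʳ _

newComponents≡sum-endsComponent : ∀ {Λ μ n} → Skew Λ μ → All (_≤ n) Λ →
  newComponents Λ μ ≡ sumFrom (λ j → endsComponent (height Λ μ j) (mult Λ j)) 1 n
newComponents≡sum-endsComponent {n = n} [] _ = sym (sumFrom-zero (λ j → refl) 1 n)
newComponents≡sum-endsComponent {l ∷ ls} {m ∷ ms} {n} s@(cons m≤l ls≤l ms≤m s′) (l≤n ∷ bs) =
  +-cancelʳ-≡ (ind (m <ᵇ head₀ ls)) _ _ (begin
    ind (m <ᵇ l) + newComponentsBelow m ls ms + ind (m <ᵇ head₀ ls)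
      ≡⟨ +-assoc (ind (m <ᵇ l)) _ _ ⟩
    ind (m <ᵇ l) + (newComponentsBelow m ls ms + ind (m <ᵇ head₀ ls))
      ≡⟨ cong (ind (m <ᵇ l) +_) (trans (newComponentsBelow-head s′ ms≤m) (newComponents≡sum-endsComponent s′ bs)) ⟩
    ind (m <ᵇ l) + sumFrom E 1 n
      ≡⟨ +-comm (ind (m <ᵇ l)) _ ⟩
    sumFrom E 1 n + ind (m <ᵇ l)
      ≡⟨ cong (sumFrom E 1 n +_) (sym (sumFrom-point′ l n _ (nonempty⇒bounded l≤n))) ⟩
    sumFrom E 1 n + sumFrom (λ j → ind ((l ≡ᵇ j) ∧ (m <ᵇ l))) 1 n
      ≡⟨ sym (sumFrom-+ _ _ 1 n) ⟩
    sumFrom (λ j → E j + ind ((l ≡ᵇ j) ∧ (m <ᵇ l))) 1 n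
      ≡⟨ sumFrom-cong (λ j → sym (endsComponent-cons s j)) 1 n ⟩
    sumFrom (λ j → E′ j + ind ((head₀ ls ≡ᵇ j) ∧ (m <ᵇ head₀ ls))) 1 n
      ≡⟨ sumFrom-+ _ _ 1 n ⟩
    sumFrom E′ 1 n + sumFrom (λ j → ind ((head₀ ls ≡ᵇ j) ∧ (m <ᵇ head₀ ls))) 1 n
      ≡⟨ cong (sumFrom E′ 1 n +_) (sumFrom-point′ (head₀ ls) n _ (nonempty⇒bounded (≤-trans (head₀≤ ls≤l) l≤n))) ⟩
    sumFrom E′ 1 n + ind (m <ᵇ head₀ ls) ∎)
  where
  open ≡-Reasoning
  E  = λ j → endsComponent (height ls ms j) (mult ls j)
  E′ = λ j → endsComponent (height (l ∷ ls) (m ∷ ms) j) (mult (l ∷ ls) j)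

sum+sum-height : ∀ {Λ μ n} → Skew Λ μ → All (_≤ n) Λ → sum μ + sumFrom (height Λ μ) 1 n ≡ sum Λ
sum+sum-height {n = n} [] _ = sumFrom-zero (λ j → refl) 1 n
sum+sum-height {l ∷ ls} {m ∷ ms} {n} (cons m≤l _ _ s) (l≤n ∷ bs) = begin
  m + sum ms + sumFrom (height (l ∷ ls) (m ∷ ms)) 1 n
    ≡⟨ cong (m + sum ms +_) (sumFrom-+ (λ j → ind ((m <ᵇ j) ∧ (j <ᵇ suc l))) (height ls ms) 1 n) ⟩
  m + sum ms + (sumFrom (λ j → ind ((m <ᵇ j) ∧ (j <ᵇ suc l))) 1 n + sumFrom (height ls ms) 1 n)
    ≡⟨ cong (λ z → m + sum ms + (z + sumFrom (height ls ms) 1 n)) (sumFrom-interval m l n m≤l l≤n) ⟩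
  m + sum ms + (l ∸ m + sumFrom (height ls ms) 1 n)
    ≡⟨ interchange m (sum ms) (l ∸ m) _ ⟩
  m + (l ∸ m) + (sum ms + sumFrom (height ls ms) 1 n)
    ≡⟨ cong₂ _+_ (m+[n∸m]≡n m≤l) (sum+sum-height s bs) ⟩
  l + sum ls ∎
  where open ≡-Reasoning

height-step : ∀ l m j → m ≤ l →
  ind ((m <ᵇ j) ∧ (j <ᵇ suc l)) + ind (m ≡ᵇ j) ≡ ind ((m <ᵇ suc j) ∧ (suc j <ᵇ suc l)) + ind (l ≡ᵇ j)
height-step l m j m≤l with <-cmp j m
... | tri< j<m _ _ rewrite <ᵇ-false {m} {j} (<⇒≤ j<m) | ≡ᵇ-false {m} {j} (λ e → <⇒≢ j<m (sym e)) | <ᵇ-false {m} {suc j} j<m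
                         | ≡ᵇ-false {l} {j} (λ e → <⇒≱ j<m (subst (m ≤_) e m≤l)) = refl
... | tri≈ _ refl _ rewrite <ᵇ-false {j} {j} ≤-refl | ≡ᵇ-refl j | <ᵇ-true (n<1+n j) with <-cmp j l
...   | tri< j<l _ _   rewrite <ᵇ-true j<l | ≡ᵇ-false {l} {j} (λ e → <⇒≢ j<l (sym e)) = refl
...   | tri≈ _ refl _ rewrite <ᵇ-false {j} {j} ≤-refl | ≡ᵇ-refl j = refl
...   | tri> _ _ l<j   = ⊥-elim (<⇒≱ l<j m≤l)
height-step l m j m≤l | tri> _ _ m<j rewrite <ᵇ-true m<j | ≡ᵇ-false {m} {j} (<⇒≢ m<j) | <ᵇ-true (m≤n⇒m≤1+n m<j) with <-cmp j l
... | tri< j<l _ _   rewrite <ᵇ-true (m≤n⇒m≤1+n j<l) | <ᵇ-true j<l | ≡ᵇ-false {l} {j} (λ e → <⇒≢ j<l (sym e)) = refl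
... | tri≈ _ refl _ rewrite <ᵇ-true (n<1+n j) | <ᵇ-false {j} {j} ≤-refl | ≡ᵇ-refl j = refl
... | tri> _ _ l<j   rewrite <ᵇ-false {j} {suc l} l<j | <ᵇ-false {j} {l} (<⇒≤ l<j) | ≡ᵇ-false {l} {j} (<⇒≢ l<j) = refl

-- Conservation a + b = c + d at the vertex of column j, where a = height j, b = mⱼ(μ), c = height (j+1), d = mⱼ(λ).
height-conservation : ∀ {Λ μ} → Skew Λ μ → ∀ j → height Λ μ j + mult μ j ≡ height Λ μ (suc j) + mult Λ j
height-conservation [] j = refl
height-conservation {l ∷ ls} {m ∷ ms} (cons m≤l _ _ s) j rewrite mult-cons m ms j | mult-cons l ls j =
  trans (interchange (ind ((m <ᵇ j) ∧ (j <ᵇ suc l))) (height ls ms j) (ind (m ≡ᵇ j)) (mult ms j))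
  (trans (cong₂ _+_ (height-step l m j m≤l) (height-conservation s j))
  (sym (interchange (ind ((m <ᵇ suc j) ∧ (suc j <ᵇ suc l))) (height ls ms (suc j)) (ind (l ≡ᵇ j)) (mult ls j))))

∧-true : ∀ {a b} → (a ∧ b) ≡ true → a ≡ true × b ≡ true
∧-true {true} {true} _ = refl , refl

∨-true : ∀ {a b} → (a ∨ b) ≡ true → a ≡ true ⊎ b ≡ true
∨-true {true}  _ = inj₁ refl
∨-true {false} e = inj₂ e

any-true : ∀ {A : Set} (f : A → Bool) {x xs} → x ∈ xs → f x ≡ true → any f xs ≡ true
any-true f x∈ e = Equivalence.to T-≡ (any⁺ f (Any.map (λ { refl → Equivalence.from T-≡ e }) x∈))

any-true⁻ : ∀ {A : Set} (f : A → Bool) xs → any f xs ≡ true → ∃ λ x → x ∈ xs × f x ≡ true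
any-true⁻ f xs e = let x , x∈ , t = find (any⁻ f xs (Equivalence.from T-≡ e)) in x , x∈ , Equivalence.to T-≡ t

any-false : ∀ {A : Set} (f : A → Bool) xs → (∀ x → x ∈ xs → f x ≡ false) → any f xs ≡ false
any-false f []       _ = refl
any-false f (y ∷ ys) h rewrite h y (here refl) = any-false f ys (λ x x∈ → h x (there x∈))

any-false⁻ : ∀ {A : Set} (f : A → Bool) xs → any f xs ≡ false → ∀ x → x ∈ xs → f x ≡ false
any-false⁻ f (y ∷ ys) e x (here refl) with f y
... | false = refl
any-false⁻ f (y ∷ ys) e x (there x∈) with f y
... | false = any-false⁻ f ys e x x∈

countᵇ-cons : ∀ {A : Set} (p : A → Bool) x xs → countᵇ p (x ∷ xs) ≡ ind (p x) + countᵇ p xs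
countᵇ-cons p x xs with p x
... | true  = refl
... | false = refl

countᵇ-applyUpTo : ∀ (p : ℕ → Bool) (f : ℕ → ℕ) k n → (∀ t → f t ≡ k + t) →
                   countᵇ p (applyUpTo f n) ≡ sumFrom (λ j → ind (p j)) k n
countᵇ-applyUpTo p f k zero    _ = refl
countᵇ-applyUpTo p f k (suc n) e rewrite countᵇ-cons p (f 0) (applyUpTo (λ t → f (suc t)) n) | e 0 | +-identityʳ k =
  cong (ind (p k) +_) (countᵇ-applyUpTo p (λ t → f (suc t)) (suc k) n (λ t → trans (e (suc t)) (+-suc k t)))

countᵇ-++ : ∀ {A : Set} (q : A → Bool) xs ys → countᵇ q (xs ++ ys) ≡ countᵇ q xs + countᵇ q ys
countᵇ-++ q []       ys = refl
countᵇ-++ q (x ∷ xs) ys with q x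
... | true  = cong suc (countᵇ-++ q xs ys)
... | false = countᵇ-++ q xs ys

countᵇ-map : ∀ {A B : Set} (q : B → Bool) (f : A → B) xs → countᵇ q (map f xs) ≡ countᵇ (λ x → q (f x)) xs
countᵇ-map q f []       = refl
countᵇ-map q f (x ∷ xs) with q (f x)
... | true  = cong suc (countᵇ-map q f xs)
... | false = countᵇ-map q f xs

countᵇ-filterᵇ : ∀ {A : Set} (p q : A → Bool) xs → countᵇ q (filterᵇ p xs) ≡ countᵇ (λ y → p y ∧ q y) xs
countᵇ-filterᵇ p q []       = refl
countᵇ-filterᵇ p q (y ∷ ys) with p y
... | false = countᵇ-filterᵇ p q ys
... | true with q y
...   | true  = cong suc (countᵇ-filterᵇ p q ys)
...   | false = countᵇ-filterᵇ p q ys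

countᵇ-cong : ∀ {A : Set} {p q : A → Bool} xs → (∀ x → x ∈ xs → p x ≡ q x) → countᵇ p xs ≡ countᵇ q xs
countᵇ-cong {q = q} []       h = refl
countᵇ-cong {q = q} (x ∷ xs) h rewrite h x (here refl) with q x
... | true  = cong suc (countᵇ-cong xs (λ y y∈ → h y (there y∈)))
... | false = countᵇ-cong xs (λ y y∈ → h y (there y∈))

countᵇ-zero : ∀ {A : Set} (q : A → Bool) xs → (∀ x → x ∈ xs → q x ≡ false) → countᵇ q xs ≡ 0
countᵇ-zero q []       h = refl
countᵇ-zero q (x ∷ xs) h rewrite h x (here refl) = countᵇ-zero q xs (λ y y∈ → h y (there y∈))

countᵇ-pos : ∀ {A : Set} (q : A → Bool) {x} xs → x ∈ xs → q x ≡ true → 0 < countᵇ q xs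
countᵇ-pos q (y ∷ ys) (here refl) e rewrite e = s≤s z≤n
countᵇ-pos q (y ∷ ys) (there x∈)  e with q y
... | true  = s≤s z≤n
... | false = countᵇ-pos q ys x∈ e

countᵇ-concatMap : ∀ {A : Set} (q : A → Bool) (F : ℕ → List A) (h : ℕ → ℕ) k n → (∀ t → h t ≡ k + t) →
                   countᵇ q (concatMap F (applyUpTo h n)) ≡ sumFrom (λ i → countᵇ q (F i)) k n
countᵇ-concatMap q F h k zero    _ = refl
countᵇ-concatMap q F h k (suc n) e
  rewrite countᵇ-++ q (F (h 0)) (concatMap F (applyUpTo (λ t → h (suc t)) n)) | e 0 | +-identityʳ k =
  cong (countᵇ q (F k) +_) (countᵇ-concatMap q F (λ t → h (suc t)) (suc k) n (λ t → trans (e (suc t)) (+-suc k t)))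

eqListᵇ-refl : ∀ xs → eqListᵇ xs xs ≡ true
eqListᵇ-refl []       = refl
eqListᵇ-refl (x ∷ xs) rewrite ≡ᵇ-refl x = eqListᵇ-refl xs

eqListᵇ-true⇒≡ : ∀ xs ys → eqListᵇ xs ys ≡ true → xs ≡ ys
eqListᵇ-true⇒≡ []       []       _ = refl
eqListᵇ-true⇒≡ (x ∷ xs) (y ∷ ys) e with ∧-true {x ≡ᵇ y} e
... | e₁ , e₂ = cong₂ _∷_ (≡ᵇ-true⇒≡ x y e₁) (eqListᵇ-true⇒≡ xs ys e₂)

eqListᵇ-sym : ∀ xs ys → eqListᵇ xs ys ≡ eqListᵇ ys xs
eqListᵇ-sym []       []       = refl
eqListᵇ-sym []       (y ∷ ys) = refl
eqListᵇ-sym (x ∷ xs) []       = refl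
eqListᵇ-sym (x ∷ xs) (y ∷ ys) = cong₂ _∧_ (≡ᵇ-sym x y) (eqListᵇ-sym xs ys)

eqListᵇ-false⇒≢ : ∀ {xs ys} → eqListᵇ xs ys ≡ false → xs ≢ ys
eqListᵇ-false⇒≢ {xs} e refl with trans (sym e) (eqListᵇ-refl xs)
... | ()

nth : List ℕ → ℕ → ℕ
nth []       _       = 0
nth (x ∷ xs) zero    = x
nth (x ∷ xs) (suc i) = nth xs i

rowCells : ℕ → ℕ → ℕ → List (ℕ × ℕ)
rowCells i c n = applyUpTo (λ t → (i , suc (c + t))) n

applyUpTo-cong : ∀ {A : Set} {f g : ℕ → A} → (∀ t → f t ≡ g t) → ∀ n → applyUpTo f n ≡ applyUpTo g n
applyUpTo-cong e zero    = refl
applyUpTo-cong e (suc n) = cong₂ _∷_ (e 0) (applyUpTo-cong (λ t → e (suc t)) n)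

rowCells-suc : ∀ i c n → rowCells i c (suc n) ≡ (i , suc c) ∷ rowCells i (suc c) n
rowCells-suc i c n = cong₂ _∷_ (cong (λ z → (i , suc z)) (+-identityʳ c))
                               (applyUpTo-cong (λ t → cong (λ z → (i , suc z)) (+-suc c t)) n)

∈-cells⁻ : ∀ k Λ μ a b → (a , b) ∈ cellsFrom k Λ μ →
           Σ[ t ∈ ℕ ] a ≡ k + t × t < length Λ × nth μ t < b × b ≤ nth Λ t
∈-cells⁻ k (l ∷ ls) (m ∷ ms) a b p with ∈-++⁻ (rowCells k m (l ∸ m)) p
... | inj₂ q = let (t , e , t< , x , y) = ∈-cells⁻ (suc k) ls ms a b q in
               suc t , trans e (sym (+-suc k t)) , s≤s t< , x , y
... | inj₁ q with ∈-applyUpTo⁻ (λ t → (k , suc (m + t))) q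
...   | t , t< , refl = 0 , sym (+-identityʳ k) , s≤s z≤n , s≤s (m≤m+n m t) ,
                        subst (_≤ l) (+-suc m t) (≤-trans (+-monoʳ-≤ m t<) (≤-reflexive (m+[n∸m]≡n m≤l)))
  where
  m≤l : m ≤ l
  m≤l = <⇒≤ (m∸n≢0⇒n<m (λ e → n≮0 (subst (t <_) e t<)))

∈-cells⁺ : ∀ k Λ μ t b → Skew Λ μ → t < length Λ → nth μ t < b → b ≤ nth Λ t → (k + t , b) ∈ cellsFrom k Λ μ
∈-cells⁺ k (l ∷ ls) (m ∷ ms) zero b _ _ m<b b≤l rewrite +-identityʳ k =
  ∈-++⁺ˡ (subst (_∈ rowCells k m (l ∸ m)) (cong (k ,_) (m+[n∸m]≡n m<b))
                (∈-applyUpTo⁺ (λ t → (k , suc (m + t))) (≤-trans (≤-reflexive (sym (+-∸-assoc 1 m<b))) (∸-monoˡ-≤ m b≤l))))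
∈-cells⁺ k (l ∷ ls) (m ∷ ms) (suc t) b (cons _ _ _ s) (s≤s t<) m<b b≤l =
  ∈-++⁺ʳ (rowCells k m (l ∸ m))
         (subst (λ z → (z , b) ∈ cellsFrom (suc k) ls ms) (sym (+-suc k t)) (∈-cells⁺ (suc k) ls ms t b s t< m<b b≤l))

nonemptyRows-nth : ∀ {Λ μ} → Skew Λ μ → nonemptyRows Λ μ ≡ sumFrom (λ i → ind (nth μ i <ᵇ nth Λ i)) 0 (length Λ)
nonemptyRows-nth [] = refl
nonemptyRows-nth {l ∷ ls} {m ∷ ms} (cons _ _ _ s) =
  cong (ind (m <ᵇ l) +_) (trans (nonemptyRows-nth s) (sym (sumFrom-suc (λ i → ind (nth (m ∷ ms) i <ᵇ nth (l ∷ ls) i)) 0 (length ls))))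

row-nonempty : ∀ Λ μ i → Skew Λ μ → i < length Λ → any (λ p → proj₁ p ≡ᵇ i) (cells Λ μ) ≡ (nth μ i <ᵇ nth Λ i)
row-nonempty Λ μ i s i< with nth μ i <ᵇ nth Λ i in eq
... | true = any-true (λ p → proj₁ p ≡ᵇ i) (∈-cells⁺ 0 Λ μ i (nth Λ i) s i< (<ᵇ-true⇒< _ _ eq) ≤-refl) (≡ᵇ-refl i)
... | false with any (λ p → proj₁ p ≡ᵇ i) (cells Λ μ) in eq′
...   | false = refl
...   | true with any-true⁻ (λ p → proj₁ p ≡ᵇ i) (cells Λ μ) eq′
...     | (a , b) , p∈ , e with ∈-cells⁻ 0 Λ μ a b p∈
...       | t , refl , _ , x , y with ≡ᵇ-true⇒≡ t i e
...         | refl = ⊥-elim (<⇒≱ (<-≤-trans x y) (<ᵇ-false⇒≥ _ _ eq))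

rowsNE≡nonemptyRows : ∀ {Λ μ} → Skew Λ μ → rowsNE Λ μ ≡ nonemptyRows Λ μ
rowsNE≡nonemptyRows {Λ} {μ} s =
  trans (countᵇ-applyUpTo _ (λ t → t) 0 (length Λ) (λ t → refl))
        (trans (sumFrom-congᵢ 0 (length Λ) (λ j _ j< → cong ind (row-nonempty Λ μ j s j<))) (sym (nonemptyRows-nth s)))

height-pos : ∀ Λ μ t j → Skew Λ μ → t < length Λ → nth μ t < j → j ≤ nth Λ t → 0 < height Λ μ j
height-pos (l ∷ ls) (m ∷ ms) zero    j _              _        m<j j≤l rewrite <ᵇ-true m<j | <ᵇ-true (s≤s j≤l) = s≤s z≤n
height-pos (l ∷ ls) (m ∷ ms) (suc t) j (cons _ _ _ s) (s≤s t<) x   y   = ≤-trans (height-pos ls ms t j s t< x y) (m≤n+m _ _)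

height-pos⁻ : ∀ Λ μ j → 0 < height Λ μ j → Σ[ t ∈ ℕ ] t < length Λ × nth μ t < j × j ≤ nth Λ t
height-pos⁻ (l ∷ ls) (m ∷ ms) j p with (m <ᵇ j) ∧ (j <ᵇ suc l) in eq
... | true  = 0 , s≤s z≤n , <ᵇ-true⇒< _ _ (proj₁ (∧-true eq)) , ≤-pred (<ᵇ-true⇒< _ _ (proj₂ (∧-true eq)))
... | false = let (t , a , b , c) = height-pos⁻ ls ms j p in suc t , s≤s a , b , c

column-nonempty : ∀ Λ μ j → Skew Λ μ → any (λ p → proj₂ p ≡ᵇ j) (cells Λ μ) ≡ (0 <ᵇ height Λ μ j)
column-nonempty Λ μ j s with 0 <ᵇ height Λ μ j in eq
... | true = let (t , a , b , c) = height-pos⁻ Λ μ j (<ᵇ-true⇒< _ _ eq) in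
             any-true (λ p → proj₂ p ≡ᵇ j) (∈-cells⁺ 0 Λ μ t j s a b c) (≡ᵇ-refl j)
... | false with any (λ p → proj₂ p ≡ᵇ j) (cells Λ μ) in eq′
...   | false = refl
...   | true with any-true⁻ (λ p → proj₂ p ≡ᵇ j) (cells Λ μ) eq′
...     | (a , b) , p∈ , e with ∈-cells⁻ 0 Λ μ a b p∈ | ≡ᵇ-true⇒≡ b j e
...       | t , refl , t< , x , y | refl = ⊥-elim (<⇒≱ (height-pos Λ μ t b s t< x y) (<ᵇ-false⇒≥ _ _ eq))

sumFrom-truncate : ∀ (f : ℕ → ℕ) N n → N ≤ n → (∀ j → N < j → f j ≡ 0) → sumFrom f 1 n ≡ sumFrom f 1 N
sumFrom-truncate f N n N≤n h = subst (λ n → sumFrom f 1 n ≡ sumFrom f 1 N) (m+[n∸m]≡n N≤n) (go (n ∸ N))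
  where
  go : ∀ d → sumFrom f 1 (N + d) ≡ sumFrom f 1 N
  go zero    rewrite +-identityʳ N = refl
  go (suc d) rewrite +-suc N d | sumFrom-snoc f 1 (N + d) | h (1 + (N + d)) (s≤s (m≤m+n N d))
                   | +-identityʳ (sumFrom f 1 (N + d)) = go d

skew-head : ∀ {Λ μ} → Skew Λ μ → All (_≤ head₀ Λ) Λ
skew-head []               = []
skew-head (cons _ ls≤l _ _) = ≤-refl ∷ ls≤l

head₀≤sum : ∀ Λ → head₀ Λ ≤ sum Λ
head₀≤sum []       = z≤n
head₀≤sum (l ∷ ls) = m≤m+n l (sum ls)

colsNE≡sum-nonempty-height : ∀ {Λ μ n} → Skew Λ μ → All (_≤ n) Λ →
  colsNE Λ μ ≡ sumFrom (λ j → ind (0 <ᵇ height Λ μ j)) 1 n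
colsNE≡sum-nonempty-height {Λ} {μ} {n} s bd = begin
  colsNE Λ μ
    ≡⟨ countᵇ-applyUpTo _ suc 1 (sum Λ) (λ t → refl) ⟩
  sumFrom (λ j → ind (any (λ p → proj₂ p ≡ᵇ j) (cells Λ μ))) 1 (sum Λ)
    ≡⟨ sumFrom-cong (λ j → cong ind (column-nonempty Λ μ j s)) 1 (sum Λ) ⟩
  sumFrom F 1 (sum Λ)
    ≡⟨ sumFrom-truncate F (head₀ Λ) (sum Λ) (head₀≤sum Λ) F-beyond ⟩
  sumFrom F 1 (head₀ Λ)
    ≡⟨ sym (sumFrom-truncate F (head₀ Λ) n (head₀≤ bd) F-beyond) ⟩
  sumFrom F 1 n ∎
  where
  open ≡-Reasoning
  F = λ j → ind (0 <ᵇ height Λ μ j)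
  F-beyond : ∀ j → head₀ Λ < j → F j ≡ 0
  F-beyond j h rewrite height-beyond {Λ} {μ} (All.map (λ p → ≤-<-trans p h) (skew-head s)) = refl

-- Connected components of a skew diagram

adj-left : ∀ i c → adjᵇ (i , suc c) (i , c) ≡ true
adj-left i c rewrite ≡ᵇ-refl i | ≡ᵇ-refl c | ∨-zeroʳ (c ≡ᵇ suc (suc c)) = refl

adj-right : ∀ i c → adjᵇ (i , c) (i , suc c) ≡ true
adj-right i c rewrite ≡ᵇ-refl i | ≡ᵇ-refl c = refl

adj-up : ∀ i c → adjᵇ (i , c) (suc i , c) ≡ true
adj-up i c rewrite ≡ᵇ-refl c | ≡ᵇ-refl i = ∨-zeroʳ _

adj-rows : ∀ a b c d → adjᵇ (a , b) (c , d) ≡ true → a < c → c ≡ suc a × b ≡ d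
adj-rows a b c d e a<c with ∨-true {(a ≡ᵇ c) ∧ ((d ≡ᵇ suc b) ∨ (b ≡ᵇ suc d))} e
... | inj₁ e₁ = ⊥-elim (<⇒≢ a<c (≡ᵇ-true⇒≡ a c (proj₁ (∧-true e₁))))
... | inj₂ e₂ with ∧-true {b ≡ᵇ d} e₂
...   | e₃ , e₄ with ∨-true {c ≡ᵇ suc a} e₄
...     | inj₁ e₅ = ≡ᵇ-true⇒≡ c (suc a) e₅ , ≡ᵇ-true⇒≡ b d e₃
...     | inj₂ e₅ = ⊥-elim (<⇒≱ a<c (subst (c ≤_) (sym (≡ᵇ-true⇒≡ a (suc c) e₅)) (n≤1+n c)))

module Reachability (cs : List (ℕ × ℕ)) where

  reach-refl : ∀ m s → reachᵇ cs m s s ≡ true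
  reach-refl zero    (i , j) rewrite ≡ᵇ-refl i | ≡ᵇ-refl j = refl
  reach-refl (suc m) s       rewrite reach-refl m s = refl

  reach-mono : ∀ {m n s t} → m ≤ n → reachᵇ cs m s t ≡ true → reachᵇ cs n s t ≡ true
  reach-mono {m} {n} {s} {t} m≤n e = subst (λ z → reachᵇ cs z s t ≡ true) (m+[n∸m]≡n m≤n) (go (n ∸ m))
    where
    go : ∀ d → reachᵇ cs (m + d) s t ≡ true
    go zero    rewrite +-identityʳ m = e
    go (suc d) rewrite +-suc m d | go d = refl

  reach-step : ∀ m s u t → u ∈ cs → adjᵇ s u ≡ true → reachᵇ cs m u t ≡ true → reachᵇ cs (suc m) s t ≡ true
  reach-step m s u t u∈ a r rewrite any-true (λ u → adjᵇ s u ∧ reachᵇ cs m u t) u∈ (trans (cong (_∧ reachᵇ cs m u t) a) r) =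
    ∨-zeroʳ (reachᵇ cs m s t)

  Cut : ℕ → Set
  Cut i = ∀ u v → u ∈ cs → v ∈ cs → proj₁ u < i → i ≤ proj₁ v → adjᵇ u v ≡ false

  reach-across-cut : ∀ i → Cut i → ∀ m q p → q ∈ cs → proj₁ q < i → i ≤ proj₁ p → reachᵇ cs m q p ≡ false
  reach-across-cut i cut zero (a , b) (c , d) _ a<i i≤c rewrite ≡ᵇ-false {a} {c} (λ e → <⇒≱ a<i (subst (i ≤_) (sym e) i≤c)) = refl
  reach-across-cut i cut (suc m) q p q∈ q< p≥ rewrite reach-across-cut i cut m q p q∈ q< p≥ =
    any-false (λ u → adjᵇ q u ∧ reachᵇ cs m u p) cs no-step
    where
    no-step : ∀ u → u ∈ cs → (adjᵇ q u ∧ reachᵇ cs m u p) ≡ false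
    no-step u u∈ with proj₁ u <? i
    ... | yes u< rewrite reach-across-cut i cut m u p u∈ u< p≥ = ∧-zeroʳ (adjᵇ q u)
    ... | no u≮  rewrite cut q u q∈ u∈ q< (≮⇒≥ u≮) = refl

  walk-left : ∀ i m k → (∀ t → t ≤ k → (i , suc (m + t)) ∈ cs) → reachᵇ cs k (i , suc (m + k)) (i , suc m) ≡ true
  walk-left i m zero    row rewrite +-identityʳ m = reach-refl 0 (i , suc m)
  walk-left i m (suc k) row = reach-step k (i , suc (m + suc k)) (i , suc (m + k)) (i , suc m) (row k (n≤1+n k))
    (subst (λ z → adjᵇ (i , suc z) (i , suc (m + k)) ≡ true) (sym (+-suc m k)) (adj-left i (suc (m + k))))
    (walk-left i m k (λ t t≤ → row t (m≤n⇒m≤1+n t≤)))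

skew-nth-decreasing : ∀ {Λ μ} → Skew Λ μ → ∀ i → nth Λ (suc i) ≤ nth Λ i × nth μ (suc i) ≤ nth μ i
skew-nth-decreasing []                                   i       = z≤n , z≤n
skew-nth-decreasing (cons _ _ _ [])                      zero    = z≤n , z≤n
skew-nth-decreasing (cons _ (a ∷ _) (b ∷ _) (cons _ _ _ _)) zero = a , b
skew-nth-decreasing (cons _ _ _ s)                       (suc i) = skew-nth-decreasing s i

row-length≤cells : ∀ k {Λ μ} → Skew Λ μ → ∀ i → nth Λ i ∸ nth μ i ≤ length (cellsFrom k Λ μ)
row-length≤cells k []             _       = z≤n
row-length≤cells k {l ∷ ls} {m ∷ ms} (cons _ _ _ s) zero
  rewrite length-++ (rowCells k m (l ∸ m)) {cellsFrom (suc k) ls ms}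
        | length-applyUpTo (λ t → (k , suc (m + t))) (l ∸ m) = m≤m+n _ _
row-length≤cells k {l ∷ ls} {m ∷ ms} (cons _ _ _ s) (suc i)
  rewrite length-++ (rowCells k m (l ∸ m)) {cellsFrom (suc k) ls ms} =
  ≤-trans (row-length≤cells (suc k) s i) (m≤n+m _ _)

length-∈ : ∀ {A : Set} {x : A} {xs} → x ∈ xs → 1 ≤ length xs
length-∈ {xs = _ ∷ _} _ = s≤s z≤n

module Components {Λ μ : List ℕ} (s : Skew Λ μ) where

  cs : List (ℕ × ℕ)
  cs = cells Λ μ

  open Reachability cs

  Above : ℕ → List (ℕ × ℕ) → Set
  Above k E = ∀ q → q ∈ E → q ∈ cs × proj₁ q < k

  above-suc : ∀ {k E} → Above k E → Above (suc k) E
  above-suc above q q∈ = proj₁ (above q q∈) , m≤n⇒m≤1+n (proj₂ (above q q∈))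

  isNew : List (ℕ × ℕ) → ℕ × ℕ → ℕ
  isNew E x = if any (λ q → connectedᵇ cs q x) E then 0 else 1

  isNew-connected : ∀ {E x y} → x ∈ E → connectedᵇ cs x y ≡ true → isNew E y ≡ 0
  isNew-connected {y = y} x∈ c rewrite any-true (λ q → connectedᵇ cs q y) x∈ c = refl

  isNew-separated : ∀ {E y} → (∀ q → q ∈ E → connectedᵇ cs q y ≡ false) → isNew E y ≡ 1
  isNew-separated {E} {y} h rewrite any-false (λ q → connectedᵇ cs q y) E h = refl

  connected-adj : ∀ {u v} → v ∈ cs → adjᵇ u v ≡ true → connectedᵇ cs u v ≡ true
  connected-adj {u} {v} v∈ a = reach-mono (length-∈ v∈) (reach-step 0 u v v v∈ a (reach-refl 0 v))

  walk-right : ∀ i c n rest E → (i , c) ∈ E → (∀ b → c < b → b ≤ c + n → (i , b) ∈ cs) → Above (suc i) E →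
    Σ[ E′ ∈ List (ℕ × ℕ) ] componentsFrom cs E (rowCells i c n ++ rest) ≡ componentsFrom cs E′ rest
                         × Above (suc i) E′ × (∀ q → q ∈ E → q ∈ E′)
  walk-right i c zero    rest E _  _   above = E , refl , above , λ _ q∈ → q∈
  walk-right i c (suc n) rest E c∈ row above =
    let E′ , eq , above′ , ⊆E′ = walk-right i (suc c) n rest ((i , suc c) ∷ E) (here refl) row′ above″ in
    E′ , trans (cong (λ xs → componentsFrom cs E (xs ++ rest)) (rowCells-suc i c n))
               (trans (cong (_+ componentsFrom cs ((i , suc c) ∷ E) (rowCells i (suc c) n ++ rest))
                                      (isNew-connected c∈ (connected-adj x∈ (adj-right i c)))) eq) ,
    above′ , λ q q∈ → ⊆E′ q (there q∈)
    where
    x∈ : (i , suc c) ∈ cs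
    x∈ = row (suc c) (n<1+n c) (subst (suc c ≤_) (sym (+-suc c n)) (s≤s (m≤m+n c n)))
    row′ : ∀ b → suc c < b → b ≤ suc c + n → (i , b) ∈ cs
    row′ b c<b b≤ = row b (<-trans (n<1+n c) c<b) (≤-trans b≤ (≤-reflexive (sym (+-suc c n))))
    above″ : Above (suc i) ((i , suc c) ∷ E)
    above″ q (here refl) = x∈ , n<1+n i
    above″ q (there q∈)  = above q q∈

  row-segment : ∀ i m l rest E → (∀ b → m < b → b ≤ l → (i , b) ∈ cs) → Above (suc i) E →
    Σ[ E′ ∈ List (ℕ × ℕ) ] componentsFrom cs E (rowCells i m (l ∸ m) ++ rest)
                             ≡ (if m <ᵇ l then isNew E (i , suc m) else 0) + componentsFrom cs E′ rest
                         × Above (suc i) E′ × (m < l → (i , suc m) ∈ E′)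
  row-segment i m l rest E row above with m <? l
  ... | no m≮l rewrite m≤n⇒m∸n≡0 (≮⇒≥ m≮l) | <ᵇ-false {m} {l} (≮⇒≥ m≮l) = E , refl , above , λ m<l → ⊥-elim (m≮l m<l)
  ... | yes m<l rewrite <ᵇ-true m<l =
    let E′ , eq , above′ , ⊆E′ = walk-right i (suc m) k rest ((i , suc m) ∷ E) (here refl) row′ above″ in
    E′ , trans (cong (λ n → componentsFrom cs E (rowCells i m n ++ rest)) (+-∸-assoc 1 m<l))
               (trans (cong (λ xs → componentsFrom cs E (xs ++ rest)) (rowCells-suc i m k))
                      (cong (isNew E (i , suc m) +_) eq)) ,
    above′ , λ _ → ⊆E′ (i , suc m) (here refl)
    where
    k = l ∸ suc m
    row′ : ∀ b → suc m < b → b ≤ suc m + k → (i , b) ∈ cs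
    row′ b m<b b≤ = row b (<-trans (n<1+n m) m<b) (subst (b ≤_) (m+[n∸m]≡n m<l) b≤)
    above″ : Above (suc i) ((i , suc m) ∷ E)
    above″ q (here refl) = row (suc m) (n<1+n m) m<l , n<1+n i
    above″ q (there q∈)  = above q q∈

  linked-to-previous-row : ∀ {i m l p} → (∀ b → m < b → b ≤ l → (suc i , b) ∈ cs) → l ∸ m ≤ length cs →
                           m ≤ p → p < l → connectedᵇ cs (i , suc p) (suc i , suc m) ≡ true
  linked-to-previous-row {i} {m} {l} {p} row bound m≤p p<l =
    reach-mono (≤-trans (≤-trans (≤-reflexive (sym (+-∸-assoc 1 m≤p))) (∸-monoˡ-≤ m p<l)) bound)
      (reach-step (p ∸ m) (i , suc p) (suc i , suc p) (suc i , suc m) (row (suc p) (s≤s m≤p) p<l) (adj-up i (suc p))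
        (subst (λ z → reachᵇ cs (p ∸ m) (suc i , suc z) (suc i , suc m) ≡ true) (m+[n∸m]≡n m≤p)
          (walk-left (suc i) m (p ∸ m) (λ t t≤ → row (suc (m + t)) (s≤s (m≤m+n m t)) (≤-trans (s≤s (m+t≤p t≤)) p<l)))))
    where
    m+t≤p : ∀ {t} → t ≤ p ∸ m → m + t ≤ p
    m+t≤p t≤ = ≤-trans (+-monoʳ-≤ m t≤) (≤-reflexive (m+[n∸m]≡n m≤p))

  rows-cut : ∀ i → nth Λ (suc i) ≤ nth μ i → Cut (suc i)
  rows-cut i h (a , b) (c , d) u∈ v∈ a< c≥ with adjᵇ (a , b) (c , d) in e
  ... | false = refl
  ... | true with adj-rows a b c d e (<-≤-trans a< c≥) | ∈-cells⁻ 0 Λ μ a b u∈ | ∈-cells⁻ 0 Λ μ c d v∈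
  ...   | refl , refl | _ , refl , _ , μᵢ<b , _ | _ , refl , _ , _ , b≤λᵢ₊₁ with ≤-antisym (≤-pred a<) (≤-pred c≥)
  ...     | refl = ⊥-elim (<⇒≱ (<-≤-trans μᵢ<b b≤λᵢ₊₁) h)

  record Suffix (i : ℕ) (ls ms : List ℕ) : Set where
    field
      nth-Λ    : ∀ t → nth Λ (suc i + t) ≡ nth ls t
      nth-μ    : ∀ t → nth μ (suc i + t) ≡ nth ms t
      length-Λ : length Λ ≡ suc i + length ls

  module _ {i l m ls ms} (sfx : Suffix i (l ∷ ls) (m ∷ ms)) where
    open Suffix sfx

    suffix-tail : Suffix (suc i) ls ms
    suffix-tail = record
      { nth-Λ    = λ t → trans (cong (nth Λ) (sym (+-suc (suc i) t))) (nth-Λ (suc t))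
      ; nth-μ    = λ t → trans (cong (nth μ) (sym (+-suc (suc i) t))) (nth-μ (suc t))
      ; length-Λ = trans length-Λ (+-suc (suc i) (length ls))
      }

    suffix-nth-Λ : nth Λ (suc i) ≡ l
    suffix-nth-Λ = trans (cong (nth Λ) (sym (+-identityʳ (suc i)))) (nth-Λ 0)

    suffix-nth-μ : nth μ (suc i) ≡ m
    suffix-nth-μ = trans (cong (nth μ) (sym (+-identityʳ (suc i)))) (nth-μ 0)

    suffix-row : ∀ b → m < b → b ≤ l → (suc i , b) ∈ cs
    suffix-row b m<b b≤l = ∈-cells⁺ 0 Λ μ (suc i) b s suc-i<len (subst (_< b) (sym suffix-nth-μ) m<b)
                                    (subst (b ≤_) (sym suffix-nth-Λ) b≤l)
      where
      suc-i<len : suc i < length Λ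
      suc-i<len = subst (suc i <_) (sym length-Λ) (subst (suc i <_) (sym (+-suc (suc i) (length ls))) (s≤s (m≤m+n (suc i) _)))

  -- A row of λ/μ is horizontally connected; it touches the row above iff they share a column, and
  -- otherwise no later cell reaches the earlier rows, so its first cell is new iff λᵢ₊₁ ≤ μᵢ.
  components-below : ∀ i p {ls ms} E → nth μ i ≡ p → Suffix i ls ms → Skew ls ms → Above (suc i) E →
    (p < nth Λ i → (i , suc p) ∈ E) → componentsFrom cs E (cellsFrom (suc i) ls ms) ≡ newComponentsBelow p ls ms
  components-below i p E _ _ [] _ _ = refl
  components-below i p {l ∷ ls} {m ∷ ms} E μᵢ≡p sfx (cons _ _ _ s′) above prev =
    let E′ , eq , above′ , first∈ = row-segment (suc i) m l (cellsFrom (suc (suc i)) ls ms) E (suffix-row sfx) (above-suc above) in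
    trans eq (cong₂ _+_ new-row
      (components-below (suc i) m E′ (suffix-nth-μ sfx) (suffix-tail sfx) s′ above′
                        (λ m<l → first∈ (subst (m <_) (suffix-nth-Λ sfx) m<l))))
    where
    m≤p : m ≤ p
    m≤p = subst₂ _≤_ (suffix-nth-μ sfx) μᵢ≡p (proj₂ (skew-nth-decreasing s i))
    l≤λᵢ : l ≤ nth Λ i
    l≤λᵢ = subst (_≤ nth Λ i) (suffix-nth-Λ sfx) (proj₁ (skew-nth-decreasing s i))
    bound : l ∸ m ≤ length cs
    bound = subst₂ (λ a b → a ∸ b ≤ length cs) (suffix-nth-Λ sfx) (suffix-nth-μ sfx) (row-length≤cells 0 s (suc i))
    new-row : (if m <ᵇ l then isNew E (suc i , suc m) else 0) ≡ ind ((m <ᵇ l) ∧ (l <ᵇ suc p))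
    new-row with m <? l
    ... | no m≮l rewrite <ᵇ-false {m} {l} (≮⇒≥ m≮l) = refl
    ... | yes m<l rewrite <ᵇ-true m<l with p <? l
    ...   | yes p<l rewrite <ᵇ-false {l} {suc p} p<l =
      isNew-connected (prev (<-≤-trans p<l l≤λᵢ)) (linked-to-previous-row (suffix-row sfx) bound m≤p p<l)
    ...   | no p≮l rewrite <ᵇ-true (s≤s (≮⇒≥ p≮l)) =
      isNew-separated (λ q q∈ → reach-across-cut (suc i) (rows-cut i λᵢ₊₁≤μᵢ) (length cs) q (suc i , suc m)
                                                 (proj₁ (above q q∈)) (proj₂ (above q q∈)) ≤-refl)
      where
      λᵢ₊₁≤μᵢ : nth Λ (suc i) ≤ nth μ i
      λᵢ₊₁≤μᵢ = subst₂ _≤_ (sym (suffix-nth-Λ sfx)) (sym μᵢ≡p) (≮⇒≥ p≮l)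

compsNE≡newComponents : ∀ {Λ μ} → Skew Λ μ → compsNE Λ μ ≡ newComponents Λ μ
compsNE≡newComponents []                                  = refl
compsNE≡newComponents {l ∷ ls} {m ∷ ms} s@(cons _ _ _ s′) =
  let E , eq , above , first∈ = row-segment 0 m l (cellsFrom 1 ls ms) [] first-row (λ _ ()) in
  trans eq (cong₂ _+_ new-first-row (components-below 0 m E refl sfx s′ above first∈))
  where
  open Components s
  sfx : Suffix 0 ls ms
  sfx = record { nth-Λ = λ t → refl ; nth-μ = λ t → refl ; length-Λ = refl }
  first-row : ∀ b → m < b → b ≤ l → (0 , b) ∈ cs
  first-row b = ∈-cells⁺ 0 (l ∷ ls) (m ∷ ms) 0 b s (s≤s z≤n)
  new-first-row : (if m <ᵇ l then 1 else 0) ≡ ind (m <ᵇ l)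
  new-first-row with m <ᵇ l
  ... | true  = refl
  ... | false = refl

-- Given the left label a and the vertical labels, conservation forces every horizontal label;
-- admissibleᵇ checks that they stay in [0 .. B] and end at 0.
admissibleᵇ : ℕ → ℕ → List ℕ → List ℕ → Bool
admissibleᵇ B a []       []       = a ≡ᵇ 0
admissibleᵇ B a (b ∷ bs) (d ∷ ds) = (d <ᵇ suc (a + b)) ∧ (((a + b ∸ d) <ᵇ suc B) ∧ admissibleᵇ B (a + b ∸ d) bs ds)
admissibleᵇ B a _        _        = false

admissible-tail : ∀ {B a b bs d ds} → admissibleᵇ B a (b ∷ bs) (d ∷ ds) ≡ true →
                  d ≤ a + b × admissibleᵇ B (a + b ∸ d) bs ds ≡ true
admissible-tail {B} {a} {b} {bs} {d} e with ∧-true {d <ᵇ suc (a + b)} e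
... | e₁ , e₂ = ≤-pred (<ᵇ-true⇒< _ _ e₁) , proj₂ (∧-true {(a + b ∸ d) <ᵇ suc B} e₂)

admissible-sum : ∀ B a bs ds → admissibleᵇ B a bs ds ≡ true → a + sum bs ≡ sum ds
admissible-sum B a []       []       e = trans (+-identityʳ a) (≡ᵇ-true⇒≡ a 0 e)
admissible-sum B a (b ∷ bs) (d ∷ ds) e with admissible-tail {B} {a} {b} {bs} {d} {ds} e
... | d≤ , e′ = begin
  a + (b + sum bs)         ≡⟨ sym (+-assoc a b (sum bs)) ⟩
  a + b + sum bs           ≡⟨ cong (_+ sum bs) (sym (m+[n∸m]≡n d≤)) ⟩
  d + (a + b ∸ d) + sum bs ≡⟨ +-assoc d (a + b ∸ d) _ ⟩
  d + (a + b ∸ d + sum bs) ≡⟨ cong (d +_) (admissible-sum B (a + b ∸ d) bs ds e′) ⟩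
  d + sum ds               ∎
  where open ≡-Reasoning

admissible-sum-drop : ∀ B a bs ds → admissibleᵇ B a bs ds ≡ true → ∀ k → sum (drop k bs) ≤ sum (drop k ds)
admissible-sum-drop B a bs       ds       e zero    = subst (sum bs ≤_) (admissible-sum B a bs ds e) (m≤n+m (sum bs) a)
admissible-sum-drop B a []       []       e (suc k) = z≤n
admissible-sum-drop B a (b ∷ bs) (d ∷ ds) e (suc k) =
  admissible-sum-drop B (a + b ∸ d) bs ds (proj₂ (admissible-tail {B} {a} {b} {bs} {d} {ds} e)) k

multsFrom : List ℕ → ℕ → ℕ → List ℕ
multsFrom ν k n = applyUpTo (λ t → mult ν (k + t)) n

multsFrom-suc : ∀ ν k n → multsFrom ν k (suc n) ≡ mult ν k ∷ multsFrom ν (suc k) n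
multsFrom-suc ν k n = cong₂ _∷_ (cong (mult ν) (+-identityʳ k)) (applyUpTo-cong (λ t → cong (mult ν) (+-suc k t)) n)

module _ {Λ μ : List ℕ} (s : Skew Λ μ) where

  mult≤height+mult : ∀ k → mult Λ k ≤ height Λ μ k + mult μ k
  mult≤height+mult k = subst (mult Λ k ≤_) (sym (height-conservation s k)) (m≤n+m (mult Λ k) (height Λ μ (suc k)))

  height-next : ∀ k → height Λ μ k + mult μ k ∸ mult Λ k ≡ height Λ μ (suc k)
  height-next k = trans (cong (_∸ mult Λ k) (height-conservation s k)) (m+n∸n≡m (height Λ μ (suc k)) (mult Λ k))

  skew-admissible : ∀ B → length Λ ≤ B → ∀ k n → height Λ μ (k + n) ≡ 0 →
                    admissibleᵇ B (height Λ μ k) (multsFrom μ k n) (multsFrom Λ k n) ≡ true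
  skew-admissible B len≤B k zero e rewrite trans (cong (height Λ μ) (sym (+-identityʳ k))) e = refl
  skew-admissible B len≤B k (suc n) e =
    subst₂ (λ bs ds → admissibleᵇ B (height Λ μ k) bs ds ≡ true) (sym (multsFrom-suc μ k n)) (sym (multsFrom-suc Λ k n)) step
    where
    step : admissibleᵇ B (height Λ μ k) (mult μ k ∷ multsFrom μ (suc k) n) (mult Λ k ∷ multsFrom Λ (suc k) n) ≡ true
    step rewrite <ᵇ-true (s≤s (mult≤height+mult k)) | height-next k | <ᵇ-true (s≤s (≤-trans (height≤length Λ μ (suc k)) len≤B)) =
      skew-admissible B len≤B (suc k) n (trans (cong (height Λ μ) (sym (+-suc k n))) e)

-- Partitions and their multiplicity vectors

Decreasing : List ℕ → Set
Decreasing = AllPairs _≥_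

decreasing-cons : ∀ {x y xs} → y ≤ x → Decreasing (y ∷ xs) → Decreasing (x ∷ y ∷ xs)
decreasing-cons y≤x (ys≤y ∷ d) = (y≤x ∷ All.map (λ p → ≤-trans p y≤x) ys≤y) ∷ ys≤y ∷ d

decreasingᵇ⇒Decreasing : ∀ xs → decreasingᵇ xs ≡ true → Decreasing xs
decreasingᵇ⇒Decreasing []           _ = []
decreasingᵇ⇒Decreasing (x ∷ [])     _ = [] ∷ []
decreasingᵇ⇒Decreasing (x ∷ y ∷ xs) e =
  decreasing-cons (≤-pred (<ᵇ-true⇒< y (suc x) (proj₁ (∧-true {y ≤ᵇ' x} e))))
                  (decreasingᵇ⇒Decreasing (y ∷ xs) (proj₂ (∧-true {y ≤ᵇ' x} e)))

Decreasing⇒decreasingᵇ : ∀ {xs} → Decreasing xs → decreasingᵇ xs ≡ true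
Decreasing⇒decreasingᵇ []                 = refl
Decreasing⇒decreasingᵇ ([] ∷ [])          = refl
Decreasing⇒decreasingᵇ {x ∷ y ∷ xs} ((y≤x ∷ _) ∷ d) rewrite <ᵇ-true {y} {suc x} (s≤s y≤x) = Decreasing⇒decreasingᵇ d

_⊆ₚ_ : List ℕ → List ℕ → Set
_⊆ₚ_ = Pointwise _≤_

skew : ∀ {Λ μ} → Decreasing Λ → Decreasing μ → μ ⊆ₚ Λ → Skew Λ μ
skew []         []         []          = []
skew (ls≤l ∷ d) (ms≤m ∷ e) (m≤l ∷ μ⊆Λ) = cons m≤l ls≤l ms≤m (skew d e μ⊆Λ)

⊆ₚ-bounded : ∀ {μ Λ L} → μ ⊆ₚ Λ → All (_≤ L) Λ → All (_≤ L) μ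
⊆ₚ-bounded []          []          = []
⊆ₚ-bounded (m≤l ∷ μ⊆Λ) (l≤L ∷ bd) = ≤-trans m≤l l≤L ∷ ⊆ₚ-bounded μ⊆Λ bd

∈-boxes⁺ : ∀ {v ls} → v ⊆ₚ ls → v ∈ boxes ls
∈-boxes⁺ []                         = here refl
∈-boxes⁺ {m ∷ ms} {l ∷ ls} (m≤l ∷ p) =
  ∈-concatMap⁺ (λ i → map (i ∷_) (boxes ls)) (Any.map (λ { refl → ∈-map⁺ (m ∷_) (∈-boxes⁺ p) }) (∈-upTo⁺ (s≤s m≤l)))

∈-boxes⁻ : ∀ {v} ls → v ∈ boxes ls → v ⊆ₚ ls
∈-boxes⁻ []       (here refl) = []
∈-boxes⁻ (l ∷ ls) v∈ with find (∈-concatMap⁻ (λ i → map (i ∷_) (boxes ls)) {xs = range0 l} v∈)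
... | i , i∈ , v∈′ with ∈-map⁻ (i ∷_) v∈′
...   | w , w∈ , refl = ≤-pred (∈-upTo⁻ i∈) ∷ ∈-boxes⁻ ls w∈

∈-subPartitions⁺ : ∀ {μ Λ} → Decreasing μ → μ ⊆ₚ Λ → μ ∈ subPartitions Λ
∈-subPartitions⁺ d μ⊆Λ = ∈-filter⁺ (λ μ → T? (decreasingᵇ μ)) (∈-boxes⁺ μ⊆Λ) (Equivalence.from T-≡ (Decreasing⇒decreasingᵇ d))

∈-subPartitions⁻ : ∀ {μ} Λ → μ ∈ subPartitions Λ → Decreasing μ × μ ⊆ₚ Λ
∈-subPartitions⁻ {μ} Λ μ∈ with ∈-filter⁻ (λ μ → T? (decreasingᵇ μ)) {xs = boxes Λ} μ∈
... | μ∈′ , t = decreasingᵇ⇒Decreasing μ (Equivalence.to T-≡ t) , ∈-boxes⁻ Λ μ∈′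

countᵇ-boxes : ∀ {v} ls → v ⊆ₚ ls → countᵇ (λ y → eqListᵇ y v) (boxes ls) ≡ 1
countᵇ-boxes []       []            = refl
countᵇ-boxes {v₀ ∷ vs} (l ∷ ls) (v₀≤l ∷ p) =
  trans (countᵇ-concatMap (λ y → eqListᵇ y (v₀ ∷ vs)) (λ i → map (i ∷_) (boxes ls)) (λ t → t) 0 (suc l) (λ t → refl))
        (trans (sumFrom-cong first-entry 0 (suc l)) (sumFrom-point v₀ 0 (suc l) z≤n (s≤s v₀≤l)))
  where
  first-entry : ∀ i → countᵇ (λ y → eqListᵇ y (v₀ ∷ vs)) (map (i ∷_) (boxes ls)) ≡ ind (i ≡ᵇ v₀)
  first-entry i rewrite countᵇ-map (λ y → eqListᵇ y (v₀ ∷ vs)) (i ∷_) (boxes ls) with i ≡ᵇ v₀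
  ... | true  = countᵇ-boxes ls p
  ... | false = countᵇ-zero _ (boxes ls) (λ _ _ → refl)

sum-drop-applyUpTo : ∀ (f : ℕ → ℕ) j L → sum (drop j (applyUpTo f L)) ≡ sumFrom f j (L ∸ j)
sum-drop-applyUpTo f zero    zero    = refl
sum-drop-applyUpTo f zero    (suc L) = cong (f 0 +_) (trans (sum-drop-applyUpTo (λ t → f (suc t)) 0 L) (sym (sumFrom-suc f 0 L)))
sum-drop-applyUpTo f (suc j) zero    = refl
sum-drop-applyUpTo f (suc j) (suc L) = trans (sum-drop-applyUpTo (λ t → f (suc t)) j L) (sym (sumFrom-suc f j (L ∸ j)))

-- partsAbove ν is the conjugate partition of ν, shifted by one: partsAbove ν j = ν′ⱼ₊₁.
partsAbove : List ℕ → ℕ → ℕ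
partsAbove ν j = countᵇ (λ p → j <ᵇ p) ν

sumFrom-part : ∀ p L j → p ≤ L → sumFrom (λ t → ind (p ≡ᵇ suc t)) j (L ∸ j) ≡ ind (j <ᵇ p)
sumFrom-part zero     L j _   = sumFrom-zero (λ _ → refl) j (L ∸ j)
sumFrom-part (suc p) L j p<L with j ≤? p
... | yes j≤p rewrite <ᵇ-true {j} {suc p} (s≤s j≤p) =
  trans (sumFrom-cong (λ t → cong ind (≡ᵇ-sym p t)) j (L ∸ j))
        (sumFrom-point p j (L ∸ j) j≤p (subst (p <_) (sym (m+[n∸m]≡n (≤-trans j≤p (<⇒≤ p<L)))) p<L))
... | no j≰p rewrite <ᵇ-false {j} {suc p} (≰⇒> j≰p) =
  trans (sumFrom-cong (λ t → cong ind (≡ᵇ-sym p t)) j (L ∸ j)) (sumFrom-point< p j (L ∸ j) (≰⇒> j≰p))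

partsAbove≡sum-drop : ∀ ν L → All (_≤ L) ν → ∀ j → partsAbove ν j ≡ sum (drop j (topBoundary ν L))
partsAbove≡sum-drop []      L _           j =
  sym (trans (sum-drop-applyUpTo (λ t → mult [] (suc t)) j L) (sumFrom-zero (λ _ → refl) j (L ∸ j)))
partsAbove≡sum-drop (p ∷ ν) L (p≤L ∷ bd) j = begin
  partsAbove (p ∷ ν) j                                              ≡⟨ countᵇ-cons (λ p → j <ᵇ p) p ν ⟩
  ind (j <ᵇ p) + partsAbove ν j                                     ≡⟨ cong₂ _+_ (sym (sumFrom-part p L j p≤L)) (partsAbove≡sum-drop ν L bd j) ⟩
  sumFrom (λ t → ind (p ≡ᵇ suc t)) j (L ∸ j) + sum (drop j (topBoundary ν L))
    ≡⟨ cong (sumFrom (λ t → ind (p ≡ᵇ suc t)) j (L ∸ j) +_) (sum-drop-applyUpTo (λ t → mult ν (suc t)) j L) ⟩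
  sumFrom (λ t → ind (p ≡ᵇ suc t)) j (L ∸ j) + sumFrom (λ t → mult ν (suc t)) j (L ∸ j)
    ≡⟨ sym (sumFrom-+ (λ t → ind (p ≡ᵇ suc t)) (λ t → mult ν (suc t)) j (L ∸ j)) ⟩
  sumFrom (λ t → ind (p ≡ᵇ suc t) + mult ν (suc t)) j (L ∸ j)       ≡⟨ sumFrom-cong (λ t → sym (mult-cons p ν (suc t))) j (L ∸ j) ⟩
  sumFrom (λ t → mult (p ∷ ν) (suc t)) j (L ∸ j)                    ≡⟨ sym (sum-drop-applyUpTo (λ t → mult (p ∷ ν) (suc t)) j L) ⟩
  sum (drop j (topBoundary (p ∷ ν) L))                              ∎
  where open ≡-Reasoning

partsAbove-bounded : ∀ {xs j} → All (_≤ j) xs → partsAbove xs j ≡ 0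
partsAbove-bounded {[]}         []          = refl
partsAbove-bounded {x ∷ xs} {j} (x≤j ∷ bd) rewrite <ᵇ-false {j} {x} x≤j = partsAbove-bounded bd

partsAbove≤length : ∀ ν j → partsAbove ν j ≤ length ν
partsAbove≤length []      j = z≤n
partsAbove≤length (p ∷ ν) j rewrite countᵇ-cons (λ p → j <ᵇ p) p ν = +-mono-≤ (ind≤1 (j <ᵇ p)) (partsAbove≤length ν j)

partsAbove-≤⇒⊆ₚ : ∀ {Λ μ} → Decreasing Λ → Decreasing μ → length μ ≡ length Λ →
                  (∀ j → partsAbove μ j ≤ partsAbove Λ j) → μ ⊆ₚ Λ
partsAbove-≤⇒⊆ₚ []         []         _   _ = []
partsAbove-≤⇒⊆ₚ {l ∷ ls} {m ∷ ms} (ls≤l ∷ d) (ms≤m ∷ e) len h = m≤l ∷ partsAbove-≤⇒⊆ₚ d e (suc-injective len) h′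
  where
  m≤l : m ≤ l
  m≤l with l <ᵇ m in eq
  ... | false = <ᵇ-false⇒≥ l m eq
  ... | true  = ⊥-elim (n≮0 (subst₂ _≤_ (trans (countᵇ-cons (λ p → l <ᵇ p) m ms) (cong (λ b → ind b + partsAbove ms l) eq))
                                        (partsAbove-bounded (≤-refl ∷ ls≤l)) (h l)))
  h′ : ∀ j → partsAbove ms j ≤ partsAbove ls j
  h′ j with j <? m
  ... | no j≮m  = subst (_≤ partsAbove ls j) (sym (partsAbove-bounded (All.map (λ p → ≤-trans p (≮⇒≥ j≮m)) ms≤m))) z≤n
  ... | yes j<m = ≤-pred (subst₂ _≤_ (above-cons m ms (<ᵇ-true j<m)) (above-cons l ls (<ᵇ-true (<-≤-trans j<m m≤l))) (h j))
    where
    above-cons : ∀ p ps → (j <ᵇ p) ≡ true → partsAbove (p ∷ ps) j ≡ suc (partsAbove ps j)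
    above-cons p ps e = trans (countᵇ-cons (λ p → j <ᵇ p) p ps) (cong (λ b → ind b + partsAbove ps j) e)

topBoundary-injective : ∀ {μ ν L} → Decreasing μ → Decreasing ν → length μ ≡ length ν → All (_≤ L) μ → All (_≤ L) ν →
                        topBoundary μ L ≡ topBoundary ν L → μ ≡ ν
topBoundary-injective {μ} {ν} {L} dμ dν len bμ bν e =
  Pointwise-≡⇒≡ (Pointwise.antisymmetric ≤-antisym (partsAbove-≤⇒⊆ₚ dν dμ len (λ j → ≤-reflexive (same j)))
                                                   (partsAbove-≤⇒⊆ₚ dμ dν (sym len) (λ j → ≤-reflexive (sym (same j)))))
  where
  same : ∀ j → partsAbove μ j ≡ partsAbove ν j
  same j = trans (partsAbove≡sum-drop μ L bμ j) (trans (cong (λ z → sum (drop j z)) e) (sym (partsAbove≡sum-drop ν L bν j)))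

fromMultiplicities : ℕ → List ℕ → List ℕ
fromMultiplicities k []       = []
fromMultiplicities k (d ∷ ds) = fromMultiplicities (suc k) ds ++ replicate d k

length-fromMultiplicities : ∀ k ds → length (fromMultiplicities k ds) ≡ sum ds
length-fromMultiplicities k []       = refl
length-fromMultiplicities k (d ∷ ds)
  rewrite length-++ (fromMultiplicities (suc k) ds) {replicate d k} | length-replicate d {k} | length-fromMultiplicities (suc k) ds =
  +-comm (sum ds) d

fromMultiplicities-≥ : ∀ k ds → All (k ≤_) (fromMultiplicities k ds)
fromMultiplicities-≥ k []       = []
fromMultiplicities-≥ k (d ∷ ds) =
  Allₚ.++⁺ (All.map (λ p → ≤-trans (n≤1+n k) p) (fromMultiplicities-≥ (suc k) ds)) (Allₚ.replicate⁺ d ≤-refl)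

fromMultiplicities-< : ∀ k ds → All (_< k + length ds) (fromMultiplicities k ds)
fromMultiplicities-< k []       = []
fromMultiplicities-< k (d ∷ ds) rewrite +-suc k (length ds) =
  Allₚ.++⁺ (fromMultiplicities-< (suc k) ds) (Allₚ.replicate⁺ d (s≤s (m≤m+n k (length ds))))

decreasing-replicate : ∀ n k → Decreasing (replicate n k)
decreasing-replicate zero    k = []
decreasing-replicate (suc n) k = Allₚ.replicate⁺ n ≤-refl ∷ decreasing-replicate n k

decreasing-fromMultiplicities : ∀ k ds → Decreasing (fromMultiplicities k ds)
decreasing-fromMultiplicities k []       = []
decreasing-fromMultiplicities k (d ∷ ds) =
  AllPairsₚ.++⁺ (decreasing-fromMultiplicities (suc k) ds) (decreasing-replicate d k)
               (All.map (λ p → Allₚ.replicate⁺ d (≤-trans (n≤1+n k) p)) (fromMultiplicities-≥ (suc k) ds))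

mult-++ : ∀ xs ys j → mult (xs ++ ys) j ≡ mult xs j + mult ys j
mult-++ xs ys j = countᵇ-++ (λ p → p ≡ᵇ j) xs ys

mult-replicate-≢ : ∀ n {k j} → k ≢ j → mult (replicate n k) j ≡ 0
mult-replicate-≢ zero    k≢j = refl
mult-replicate-≢ (suc n) k≢j rewrite ≡ᵇ-false k≢j = mult-replicate-≢ n k≢j

mult-replicate : ∀ n k → mult (replicate n k) k ≡ n
mult-replicate zero    k = refl
mult-replicate (suc n) k rewrite ≡ᵇ-refl k = cong suc (mult-replicate n k)

mult-before : ∀ {xs j} → All (j <_) xs → mult xs j ≡ 0
mult-before {[]}         []        = refl
mult-before {x ∷ xs} {j} (j<x ∷ a) rewrite ≡ᵇ-false {x} {j} (λ e → <⇒≢ j<x (sym e)) = mult-before a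

multsFrom-fromMultiplicities : ∀ k ds → multsFrom (fromMultiplicities k ds) k (length ds) ≡ ds
multsFrom-fromMultiplicities k []       = refl
multsFrom-fromMultiplicities k (d ∷ ds) =
  cong₂ _∷_ first (trans (applyUpTo-cong rest (length ds)) (multsFrom-fromMultiplicities (suc k) ds))
  where
  P = fromMultiplicities (suc k) ds
  first : mult (P ++ replicate d k) (k + 0) ≡ d
  first rewrite +-identityʳ k | mult-++ P (replicate d k) k | mult-before {P} {k} (fromMultiplicities-≥ (suc k) ds) = mult-replicate d k
  rest : ∀ t → mult (P ++ replicate d k) (k + suc t) ≡ mult P (suc k + t)
  rest t rewrite +-suc k t | mult-++ P (replicate d k) (suc (k + t))
               | mult-replicate-≢ d {k} {suc (k + t)} (<⇒≢ (s≤s (m≤m+n k t))) = +-identityʳ _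

admissible-bottom-is-subPartition : ∀ {Λ L B a ds} → Decreasing Λ → All (_≤ L) Λ → length ds ≡ L →
  admissibleᵇ B a ds (topBoundary Λ L) ≡ true → Σ[ μ ∈ List ℕ ] μ ∈ subPartitions Λ × topBoundary μ L ≡ ds
admissible-bottom-is-subPartition {Λ} {L} {B} {a} {ds} dΛ bdΛ len-ds adm = μ , ∈-subPartitions⁺ dμ μ⊆Λ , top-μ
  where
  P = fromMultiplicities 1 ds
  Z = replicate (length Λ ∸ sum ds) 0
  μ = P ++ Z
  sum-ds≤ : sum ds ≤ length Λ
  sum-ds≤ = ≤-trans (admissible-sum-drop B a ds (topBoundary Λ L) adm 0)
                    (subst (_≤ length Λ) (partsAbove≡sum-drop Λ L bdΛ 0) (partsAbove≤length Λ 0))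
  len-μ : length μ ≡ length Λ
  len-μ rewrite length-++ P {Z} | length-fromMultiplicities 1 ds | length-replicate (length Λ ∸ sum ds) {0} = m+[n∸m]≡n sum-ds≤
  dμ : Decreasing μ
  dμ = AllPairsₚ.++⁺ (decreasing-fromMultiplicities 1 ds) (decreasing-replicate _ 0)
                    (All.map (λ _ → Allₚ.replicate⁺ _ z≤n) (fromMultiplicities-≥ 1 ds))
  bdμ : All (_≤ L) μ
  bdμ = Allₚ.++⁺ (All.map (λ {x} p → ≤-pred (subst (x <_) (cong suc len-ds) p)) (fromMultiplicities-< 1 ds))
                (Allₚ.replicate⁺ _ z≤n)
  top-μ : topBoundary μ L ≡ ds
  top-μ = trans (applyUpTo-cong (λ t → trans (mult-++ P Z (suc t))
                                             (trans (cong (mult P (suc t) +_) (mult-replicate-≢ (length Λ ∸ sum ds) (λ ())))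
                                                    (+-identityʳ _))) L)
                (subst (λ n → multsFrom P 1 n ≡ ds) len-ds (multsFrom-fromMultiplicities 1 ds))
  μ⊆Λ : μ ⊆ₚ Λ
  μ⊆Λ = partsAbove-≤⇒⊆ₚ dΛ dμ len-μ (λ j →
          subst₂ _≤_ (sym (trans (partsAbove≡sum-drop μ L bdμ j) (cong (λ z → sum (drop j z)) top-μ)))
                     (sym (partsAbove≡sum-drop Λ L bdΛ j))
                     (admissible-sum-drop B a ds (topBoundary Λ L) adm j))

allVecs≡boxes : ∀ L B → allVecs L B ≡ boxes (replicate L B)
allVecs≡boxes zero    B = refl
allVecs≡boxes (suc L) B = cong (λ z → concatMap (λ i → map (i ∷_) z) (range0 B)) (allVecs≡boxes L B)

allVecs-length : ∀ {L B ds} → ds ∈ allVecs L B → length ds ≡ L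
allVecs-length {L} {B} {ds} ds∈ =
  trans (Pointwise-length (∈-boxes⁻ (replicate L B) (subst (ds ∈_) (allVecs≡boxes L B) ds∈))) (length-replicate L)

mult≤length : ∀ ν j → mult ν j ≤ length ν
mult≤length []      j = z≤n
mult≤length (p ∷ ν) j rewrite mult-cons p ν j = +-mono-≤ (ind≤1 (p ≡ᵇ j)) (mult≤length ν j)

applyUpTo-⊆ₚ : ∀ (f : ℕ → ℕ) L B → (∀ t → f t ≤ B) → applyUpTo f L ⊆ₚ replicate L B
applyUpTo-⊆ₚ f zero    B h = []
applyUpTo-⊆ₚ f (suc L) B h = h 0 ∷ applyUpTo-⊆ₚ (λ t → f (suc t)) L B (λ t → h (suc t))

topBoundary-⊆ₚ : ∀ μ L B → length μ ≤ B → topBoundary μ L ⊆ₚ replicate L B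
topBoundary-⊆ₚ μ L B len≤B = applyUpTo-⊆ₚ _ L B (λ t → ≤-trans (mult≤length μ (suc t)) len≤B)

countᵇ-subPartitions : ∀ Λ {μ} → μ ∈ subPartitions Λ → countᵇ (λ ν → eqListᵇ ν μ) (subPartitions Λ) ≡ 1
countᵇ-subPartitions Λ {μ} μ∈ =
  trans (countᵇ-filterᵇ decreasingᵇ (λ ν → eqListᵇ ν μ) (boxes Λ))
        (trans (countᵇ-cong (boxes Λ) only-μ) (countᵇ-boxes Λ (proj₂ (∈-subPartitions⁻ Λ μ∈))))
  where
  only-μ : ∀ ν → ν ∈ boxes Λ → (decreasingᵇ ν ∧ eqListᵇ ν μ) ≡ eqListᵇ ν μ
  only-μ ν _ with eqListᵇ ν μ in e
  ... | true rewrite eqListᵇ-true⇒≡ ν μ e = trans (∧-identityʳ _) (Decreasing⇒decreasingᵇ {μ} (proj₁ (∈-subPartitions⁻ Λ μ∈)))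
  ... | false = ∧-zeroʳ (decreasingᵇ ν)

allZeroᵇ≡eqListᵇ-zeros : ∀ μ → allZeroᵇ μ ≡ eqListᵇ μ (replicate (length μ) 0)
allZeroᵇ≡eqListᵇ-zeros []       = refl
allZeroᵇ≡eqListᵇ-zeros (x ∷ xs) = cong ((x ≡ᵇ 0) ∧_) (allZeroᵇ≡eqListᵇ-zeros xs)

zeros-⊆ₚ : ∀ ls → replicate (length ls) 0 ⊆ₚ ls
zeros-⊆ₚ []       = []
zeros-⊆ₚ (l ∷ ls) = z≤n ∷ zeros-⊆ₚ ls

zeros∈subPartitions : ∀ Λ → replicate (length Λ) 0 ∈ subPartitions Λ
zeros∈subPartitions Λ = ∈-subPartitions⁺ (decreasing-replicate (length Λ) 0) (zeros-⊆ₚ Λ)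

topBoundary-zeros : ∀ k L → topBoundary (replicate k 0) L ≡ replicate L 0
topBoundary-zeros k L = trans (applyUpTo-cong (λ t → mult-replicate-≢ k (λ ())) L) (zeros L)
  where
  zeros : ∀ n → applyUpTo (λ _ → 0) n ≡ replicate n 0
  zeros zero    = refl
  zeros (suc n) = cong (0 ∷_) (zeros n)

topBoundary∈allVecs : ∀ {μ} L B → length μ ≤ B → topBoundary μ L ∈ allVecs L B
topBoundary∈allVecs {μ} L B len≤B = subst (topBoundary μ L ∈_) (sym (allVecs≡boxes L B)) (∈-boxes⁺ (topBoundary-⊆ₚ μ L B len≤B))

-- Exponents of the vertex weight w(a, d) = (α+β)^{exp-αβ} (α+x)^{exp-αx} β^{exp-β} x^{exp-x}

exp-αβ exp-αx exp-β exp-x : ℕ → ℕ → ℕ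
exp-αβ a d = if d <ᵇ a then a ∸ d ∸ 1 else 0
exp-αx a d = if d <ᵇ a then 1 else 0
exp-β  a d = if d <ᵇ a then d else (if 0 <ᵇ a then a ∸ 1 else 0)
exp-x  a d = if d <ᵇ a then 0 else (if 0 <ᵇ a then 1 else 0)

exp-x≡endsComponent : ∀ a d → exp-x a d ≡ endsComponent a d
exp-x≡endsComponent a d with d <ᵇ a in eq
... | true rewrite <ᵇ-false {a} {suc d} (<ᵇ-true⇒< d a eq) = cong ind (sym (∧-zeroʳ (0 <ᵇ a)))
... | false with a
...   | zero    = refl
...   | suc a′ rewrite <ᵇ-true {suc a′} {suc d} (s≤s (<ᵇ-false⇒≥ d (suc a′) eq)) = refl

exp-αx+exp-x : ∀ a d → exp-αx a d + exp-x a d ≡ ind (0 <ᵇ a)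
exp-αx+exp-x a d with d <ᵇ a in eq
... | true rewrite <ᵇ-true {0} {a} (≤-<-trans z≤n (<ᵇ-true⇒< d a eq)) = refl
... | false with a
...   | zero   = refl
...   | suc a′ = refl

exp-β+exp-x : ∀ a d → exp-β a d + exp-x a d ≡ a ⊓ d
exp-β+exp-x a d with d <ᵇ a in eq
... | true  = trans (+-identityʳ d) (sym (m≥n⇒m⊓n≡n (<⇒≤ (<ᵇ-true⇒< d a eq))))
... | false with a
...   | zero   = refl
...   | suc a′ = trans (+-comm a′ 1) (sym (m≤n⇒m⊓n≡m (<ᵇ-false⇒≥ d (suc a′) eq)))

exponents-sum : ∀ a d → exp-αβ a d + exp-αx a d + exp-β a d + exp-x a d ≡ a
exponents-sum a d with d <ᵇ a in eq
... | true = begin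
  a ∸ d ∸ 1 + 1 + d + 0 ≡⟨ +-identityʳ _ ⟩
  a ∸ d ∸ 1 + 1 + d     ≡⟨ cong (_+ d) (m∸n+n≡m (m<n⇒0<n∸m d<a)) ⟩
  a ∸ d + d             ≡⟨ m∸n+n≡m (<⇒≤ d<a) ⟩
  a                     ∎
  where
  open ≡-Reasoning
  d<a = <ᵇ-true⇒< d a eq
... | false with a
...   | zero   = refl
...   | suc a′ = +-comm a′ 1

columnSum : List ℕ → List ℕ → ℕ → (ℕ → ℕ → ℕ) → ℕ
columnSum Λ μ L f = sumFrom (λ j → f (height Λ μ j) (mult Λ j)) 1 L

module _ {Λ μ L} (s : Skew Λ μ) (bd : All (_≤ L) Λ) where

  rowsNE≡exponents : rowsNE Λ μ ≡ columnSum Λ μ L exp-β + columnSum Λ μ L exp-x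
  rowsNE≡exponents =
    trans (rowsNE≡nonemptyRows s) (trans (nonemptyRows≡sum-height⊓mult s bd)
          (trans (sumFrom-cong (λ j → sym (exp-β+exp-x (height Λ μ j) (mult Λ j))) 1 L) (sumFrom-+ _ _ 1 L)))

  colsNE≡exponents : colsNE Λ μ ≡ columnSum Λ μ L exp-αx + columnSum Λ μ L exp-x
  colsNE≡exponents =
    trans (colsNE≡sum-nonempty-height s bd)
          (trans (sumFrom-cong (λ j → sym (exp-αx+exp-x (height Λ μ j) (mult Λ j))) 1 L) (sumFrom-+ _ _ 1 L))

  compsNE≡exponents : compsNE Λ μ ≡ columnSum Λ μ L exp-x
  compsNE≡exponents =
    trans (compsNE≡newComponents s) (trans (newComponents≡sum-endsComponent s bd)
          (sumFrom-cong (λ j → sym (exp-x≡endsComponent (height Λ μ j) (mult Λ j))) 1 L))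

  size≡exponents : sum Λ ∸ sum μ ≡ columnSum Λ μ L exp-αβ + columnSum Λ μ L exp-αx + columnSum Λ μ L exp-β + columnSum Λ μ L exp-x
  size≡exponents = begin
    sum Λ ∸ sum μ                            ≡⟨ cong (_∸ sum μ) (sym (sum+sum-height s bd)) ⟩
    sum μ + S (height Λ μ) ∸ sum μ           ≡⟨ m+n∸m≡n (sum μ) (S (height Λ μ)) ⟩
    S (height Λ μ)                           ≡⟨ sumFrom-cong (λ j → sym (exponents-sum (height Λ μ j) (mult Λ j))) 1 L ⟩
    S (λ j → e₁ j + e₂ j + e₃ j + e₄ j)      ≡⟨ sumFrom-+ (λ j → e₁ j + e₂ j + e₃ j) e₄ 1 L ⟩
    S (λ j → e₁ j + e₂ j + e₃ j) + S e₄      ≡⟨ cong (_+ S e₄) (sumFrom-+ (λ j → e₁ j + e₂ j) e₃ 1 L) ⟩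
    S (λ j → e₁ j + e₂ j) + S e₃ + S e₄      ≡⟨ cong (λ z → z + S e₃ + S e₄) (sumFrom-+ e₁ e₂ 1 L) ⟩
    S e₁ + S e₂ + S e₃ + S e₄                ∎
    where
    open ≡-Reasoning
    S : (ℕ → ℕ) → ℕ
    S f = sumFrom f 1 L
    e₁ e₂ e₃ e₄ : ℕ → ℕ
    e₁ j = exp-αβ (height Λ μ j) (mult Λ j)
    e₂ j = exp-αx (height Λ μ j) (mult Λ j)
    e₃ j = exp-β  (height Λ μ j) (mult Λ j)
    e₄ j = exp-x  (height Λ μ j) (mult Λ j)

exp-αβ-total : ∀ E₁ C₁ E₂ C₂ → E₁ + C₁ + E₂ + C₂ + C₂ ∸ (E₂ + C₂ + (C₁ + C₂)) ≡ E₁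
exp-αβ-total E₁ C₁ E₂ C₂ = trans (cong (_∸ (E₂ + C₂ + (C₁ + C₂))) (rearrange E₁ C₁ E₂ C₂)) (m+n∸n≡m E₁ (E₂ + C₂ + (C₁ + C₂)))
  where
  rearrange : ∀ E₁ C₁ E₂ C₂ → E₁ + C₁ + E₂ + C₂ + C₂ ≡ E₁ + (E₂ + C₂ + (C₁ + C₂))
  rearrange = solve-∀

module Sums {c ℓ} (R : CommutativeRing c ℓ) where

  open CommutativeRing R
    using (Carrier; _≈_; 0#; 1#; zeroˡ; zeroʳ; distribˡ; distribʳ)
    renaming ( _+_ to _⊕_; _*_ to _⊗_; refl to ≈-refl; sym to ≈-sym; trans to ≈-trans; reflexive to ≈-reflexive
             ; +-cong to ⊕-cong; +-congˡ to ⊕-congˡ; +-identityˡ to ⊕-identityˡ; +-identityʳ to ⊕-identityʳ)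
  open import Algebra.Properties.CommutativeSemigroup (CommutativeRing.+-commutativeSemigroup R)
    using () renaming (interchange to ⊕-interchange)

  ∑ : {A : Set} → (A → Carrier) → List A → Carrier
  ∑ = Defs.Σ R

  ∑-cong : ∀ {A : Set} {f g : A → Carrier} xs → (∀ x → x ∈ xs → f x ≈ g x) → ∑ f xs ≈ ∑ g xs
  ∑-cong []       h = ≈-refl
  ∑-cong (x ∷ xs) h = ⊕-cong (h x (here refl)) (∑-cong xs (λ y y∈ → h y (there y∈)))

  ∑-zero : ∀ {A : Set} {f : A → Carrier} xs → (∀ x → x ∈ xs → f x ≈ 0#) → ∑ f xs ≈ 0#
  ∑-zero []       h = ≈-refl
  ∑-zero (x ∷ xs) h = ≈-trans (⊕-cong (h x (here refl)) (∑-zero xs (λ y y∈ → h y (there y∈)))) (⊕-identityˡ 0#)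

  ∑-distribˡ : ∀ {A : Set} (f : A → Carrier) y xs → y ⊗ ∑ f xs ≈ ∑ (λ x → y ⊗ f x) xs
  ∑-distribˡ f y []       = zeroʳ y
  ∑-distribˡ f y (x ∷ xs) = ≈-trans (distribˡ y (f x) (∑ f xs)) (⊕-congˡ (∑-distribˡ f y xs))

  ∑-distribʳ : ∀ {A : Set} (f : A → Carrier) y xs → ∑ f xs ⊗ y ≈ ∑ (λ x → f x ⊗ y) xs
  ∑-distribʳ f y []       = zeroˡ y
  ∑-distribʳ f y (x ∷ xs) = ≈-trans (distribʳ y (f x) (∑ f xs)) (⊕-congˡ (∑-distribʳ f y xs))

  ∑-+ : ∀ {A : Set} (f g : A → Carrier) xs → ∑ (λ x → f x ⊕ g x) xs ≈ ∑ f xs ⊕ ∑ g xs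
  ∑-+ f g []       = ≈-sym (⊕-identityˡ 0#)
  ∑-+ f g (x ∷ xs) = ≈-trans (⊕-congˡ (∑-+ f g xs)) (⊕-interchange (f x) (g x) (∑ f xs) (∑ g xs))

  ∑-swap : ∀ {A B : Set} (f : A → B → Carrier) xs ys → ∑ (λ x → ∑ (f x) ys) xs ≈ ∑ (λ y → ∑ (λ x → f x y) xs) ys
  ∑-swap f []       ys = ≈-sym (∑-zero ys (λ _ _ → ≈-refl))
  ∑-swap f (x ∷ xs) ys = ≈-trans (⊕-congˡ (∑-swap f xs ys)) (≈-sym (∑-+ (f x) (λ y → ∑ (λ x′ → f x′ y) xs) ys))

  ∑-applyUpTo-single : ∀ (f : ℕ → Carrier) k n p → k ≤ p → p < k + n → (∀ j → j ≢ p → f j ≈ 0#) →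
                       ∑ f (applyUpTo (k +_) n) ≈ f p
  ∑-applyUpTo-single f k zero    p k≤p p< _ = ⊥-elim (<⇒≱ p< (subst (_≤ p) (sym (+-identityʳ k)) k≤p))
  ∑-applyUpTo-single f k (suc n) p k≤p p< z with k ≟ p
  ... | yes refl = ≈-trans (⊕-cong (≈-reflexive (cong f (+-identityʳ k))) (∑-zero _ others-zero)) (⊕-identityʳ (f k))
    where
    others-zero : ∀ j → j ∈ applyUpTo (λ t → k + suc t) n → f j ≈ 0#
    others-zero j j∈ with ∈-applyUpTo⁻ (λ t → k + suc t) j∈
    ... | t , _ , refl = z _ (λ e → <⇒≢ (m<m+n k (s≤s z≤n)) (sym e))
  ... | no k≢p = ≈-trans (⊕-cong (z (k + 0) (λ e → k≢p (trans (sym (+-identityʳ k)) e)))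
                              (≈-trans (≈-reflexive (cong (λ xs → ∑ f xs) (applyUpTo-cong (λ t → +-suc k t) n)))
                                     (∑-applyUpTo-single f (suc k) n p (≤∧≢⇒< k≤p k≢p) (≤-trans p< (≤-reflexive (+-suc k n))) z)))
                       (⊕-identityˡ (f p))

  ∑-select : ∀ {A : Set} (p : A → Bool) (h : A → Carrier) xs {y} → countᵇ p xs ≡ 1 → y ∈ xs → p y ≡ true →
             ∑ (λ z → if p z then h z else 0#) xs ≈ h y
  ∑-select p h (x ∷ xs) {y} one y∈ py with p x in px
  ∑-select p h (x ∷ xs) one (here refl) py | true =
    ≈-trans (⊕-congˡ (∑-zero xs none-after)) (⊕-identityʳ _)
    where
    none-after : ∀ z → z ∈ xs → (if p z then h z else 0#) ≈ 0#
    none-after z z∈ with p z in pz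
    ... | false = ≈-refl
    ... | true  = ⊥-elim (<⇒≢ (countᵇ-pos p xs z∈ pz) (sym (suc-injective one)))
  ∑-select p h (x ∷ xs) one (there y∈) py | true = ⊥-elim (<⇒≢ (countᵇ-pos p xs y∈ py) (sym (suc-injective one)))
  ∑-select p h (x ∷ xs) one (here refl) py | false with trans (sym px) py
  ... | ()
  ∑-select p h (x ∷ xs) one (there y∈) py | false = ≈-trans (⊕-identityˡ _) (∑-select p h xs one y∈ py)

module LatticeModel {c ℓ} (R : CommutativeRing c ℓ) (α β : CommutativeRing.Carrier R) where

  open CommutativeRing R
    using (Carrier; _≈_; 0#; 1#; zeroˡ; zeroʳ; *-commutativeMonoid)
    renaming ( _+_ to _⊕_; _*_ to _⊗_; refl to ≈-refl; sym to ≈-sym; trans to ≈-trans; reflexive to ≈-reflexive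
             ; +-comm to ⊕-comm; +-identityˡ to ⊕-identityˡ; +-identityʳ to ⊕-identityʳ; +-cong to ⊕-cong; +-congˡ to ⊕-congˡ
             ; *-cong to ⊗-cong; *-congˡ to ⊗-congˡ; *-congʳ to ⊗-congʳ
             ; *-identityˡ to ⊗-identityˡ; *-assoc to ⊗-assoc)
  open Sums R
  open import Relation.Binary.Reasoning.Setoid (CommutativeRing.setoid R)
  open import Algebra.Solver.CommutativeMonoid *-commutativeMonoid using (solve; _⊜_) renaming (_⊕_ to _·_; id to ε)

  pow-+ : ∀ y m n → pow R y (m + n) ≈ pow R y m ⊗ pow R y n
  pow-+ y zero    n = ≈-sym (⊗-identityˡ _)
  pow-+ y (suc m) n = ≈-trans (⊗-congˡ (pow-+ y m n)) (≈-sym (⊗-assoc y _ _))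

  prodFrom : (ℕ → Carrier) → ℕ → ℕ → Carrier
  prodFrom F k zero    = 1#
  prodFrom F k (suc n) = F k ⊗ prodFrom F (suc k) n

  prodFrom-cong : ∀ {F G : ℕ → Carrier} → (∀ j → F j ≈ G j) → ∀ k n → prodFrom F k n ≈ prodFrom G k n
  prodFrom-cong e k zero    = ≈-refl
  prodFrom-cong e k (suc n) = ⊗-cong (e k) (prodFrom-cong e (suc k) n)

  vertexWeight : Carrier → ℕ → ℕ → Carrier
  vertexWeight x a d =
    if d <ᵇ a then pow R (α ⊕ β) (a ∸ d ∸ 1) ⊗ (x ⊕ α) ⊗ pow R β d
    else (if 0 <ᵇ a then pow R β (a ∸ 1) ⊗ x else 1#)

  monomial : Carrier → ℕ → ℕ → ℕ → ℕ → Carrier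
  monomial x p q r s = pow R (α ⊕ β) p ⊗ pow R (α ⊕ x) q ⊗ pow R β r ⊗ pow R x s

  vertexWeight-monomial : ∀ x a d → vertexWeight x a d ≈ monomial x (exp-αβ a d) (exp-αx a d) (exp-β a d) (exp-x a d)
  vertexWeight-monomial x a d with d <ᵇ a
  ... | true = ≈-trans (⊗-congʳ (⊗-congˡ (⊕-comm x α)))
                       (solve 3 (λ A y B → (A · y) · B ⊜ ((A · (y · ε)) · B) · ε) ≈-refl
                              (pow R (α ⊕ β) (a ∸ d ∸ 1)) (α ⊕ x) (pow R β d))
  ... | false with a
  ...   | zero   = solve 0 (ε ⊜ ((ε · ε) · ε) · ε) ≈-refl
  ...   | suc a′ = solve 2 (λ B y → B · y ⊜ ((ε · ε) · B) · (y · ε)) ≈-refl (pow R β a′) x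

  monomial-* : ∀ x p q r s p′ q′ r′ s′ → monomial x p q r s ⊗ monomial x p′ q′ r′ s′ ≈ monomial x (p + p′) (q + q′) (r + r′) (s + s′)
  monomial-* x p q r s p′ q′ r′ s′ = ≈-trans
    (solve 8 (λ P Q S T P′ Q′ S′ T′ → (((P · Q) · S) · T) · (((P′ · Q′) · S′) · T′) ⊜ (((P · P′) · (Q · Q′)) · (S · S′)) · (T · T′))
           ≈-refl (pow R (α ⊕ β) p) (pow R (α ⊕ x) q) (pow R β r) (pow R x s)
                  (pow R (α ⊕ β) p′) (pow R (α ⊕ x) q′) (pow R β r′) (pow R x s′))
    (≈-sym (⊗-cong (⊗-cong (⊗-cong (pow-+ (α ⊕ β) p p′) (pow-+ (α ⊕ x) q q′)) (pow-+ β r r′)) (pow-+ x s s′)))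

  prodFrom-monomial : ∀ x (f₁ f₂ f₃ f₄ : ℕ → ℕ) k n →
    prodFrom (λ j → monomial x (f₁ j) (f₂ j) (f₃ j) (f₄ j)) k n
      ≈ monomial x (sumFrom f₁ k n) (sumFrom f₂ k n) (sumFrom f₃ k n) (sumFrom f₄ k n)
  prodFrom-monomial x f₁ f₂ f₃ f₄ k zero    = solve 0 (ε ⊜ ((ε · ε) · ε) · ε) ≈-refl
  prodFrom-monomial x f₁ f₂ f₃ f₄ k (suc n) =
    ≈-trans (⊗-congˡ (prodFrom-monomial x f₁ f₂ f₃ f₄ (suc k) n))
            (monomial-* x (f₁ k) (f₂ k) (f₃ k) (f₄ k)
                          (sumFrom f₁ (suc k) n) (sumFrom f₂ (suc k) n) (sumFrom f₃ (suc k) n) (sumFrom f₄ (suc k) n))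

  skewFormula : Carrier → ℕ → ℕ → ℕ → ℕ → Carrier
  skewFormula x r cc b s = pow R β (r ∸ b) ⊗ pow R (α ⊕ β) ((s + b) ∸ (r + cc)) ⊗ pow R x b ⊗ pow R (α ⊕ x) (cc ∸ b)

  skewFormula-monomial : ∀ x E₁ C₁ E₂ C₂ →
    skewFormula x (E₂ + C₂) (C₁ + C₂) C₂ (E₁ + C₁ + E₂ + C₂) ≈ monomial x E₁ C₁ E₂ C₂
  skewFormula-monomial x E₁ C₁ E₂ C₂ rewrite m+n∸n≡m E₂ C₂ | m+n∸n≡m C₁ C₂ | exp-αβ-total E₁ C₁ E₂ C₂ =
    solve 4 (λ a b c d → ((a · b) · c) · d ⊜ ((b · d) · a) · c) ≈-refl
          (pow R β E₂) (pow R (α ⊕ β) E₁) (pow R x C₂) (pow R (α ⊕ x) C₁)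

  gSkew≡prod-vertexWeight : ∀ x {Λ μ L} → Skew Λ μ → All (_≤ L) Λ →
    gSkew R α β x Λ μ ≈ prodFrom (λ j → vertexWeight x (height Λ μ j) (mult Λ j)) 1 L
  gSkew≡prod-vertexWeight x {Λ} {μ} {L} s bd = begin
    gSkew R α β x Λ μ
      ≡⟨ cong₂ (λ r cc → skewFormula x r cc (compsNE Λ μ) (sum Λ ∸ sum μ)) (rowsNE≡exponents s bd) (colsNE≡exponents s bd) ⟩
    skewFormula x (E exp-β + E exp-x) (E exp-αx + E exp-x) (compsNE Λ μ) (sum Λ ∸ sum μ)
      ≡⟨ cong₂ (skewFormula x _ _) (compsNE≡exponents s bd) (size≡exponents s bd) ⟩
    skewFormula x (E exp-β + E exp-x) (E exp-αx + E exp-x) (E exp-x) (E exp-αβ + E exp-αx + E exp-β + E exp-x)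
      ≈⟨ skewFormula-monomial x (E exp-αβ) (E exp-αx) (E exp-β) (E exp-x) ⟩
    monomial x (E exp-αβ) (E exp-αx) (E exp-β) (E exp-x)
      ≈⟨ ≈-sym (prodFrom-monomial x (e exp-αβ) (e exp-αx) (e exp-β) (e exp-x) 1 L) ⟩
    prodFrom (λ j → monomial x (e exp-αβ j) (e exp-αx j) (e exp-β j) (e exp-x j)) 1 L
      ≈⟨ ≈-sym (prodFrom-cong (λ j → vertexWeight-monomial x (height Λ μ j) (mult Λ j)) 1 L) ⟩
    prodFrom (λ j → vertexWeight x (height Λ μ j) (mult Λ j)) 1 L ∎
    where
    e : (ℕ → ℕ → ℕ) → ℕ → ℕ
    e f j = f (height Λ μ j) (mult Λ j)
    E : (ℕ → ℕ → ℕ) → ℕ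
    E f = columnSum Λ μ L f

  rowFrom-cons : ∀ B x a b bs d ds → d ≤ a + b → a + b ∸ d ≤ B →
    rowFrom R α β B x a (b ∷ bs) (d ∷ ds) ≈ vertexWeight x a d ⊗ rowFrom R α β B x (a + b ∸ d) bs ds
  rowFrom-cons B x a b bs d ds d≤ c≤B =
    ≈-trans (∑-applyUpTo-single _ 0 (suc B) (a + b ∸ d) z≤n (s≤s c≤B) other-labels)
            (⊗-congʳ (≈-reflexive (cong (λ t → if t then vertexWeight x a d else 0#)
                                        (trans (cong ((a + b) ≡ᵇ_) (m∸n+n≡m d≤)) (≡ᵇ-refl (a + b))))))
    where
    other-labels : ∀ c′ → c′ ≢ a + b ∸ d → weight R α β x a b c′ d ⊗ rowFrom R α β B x c′ bs ds ≈ 0#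
    other-labels c′ c′≢ rewrite ≡ᵇ-false {a + b} {c′ + d} (λ e → c′≢ (trans (sym (m+n∸n≡m c′ d)) (cong (_∸ d) (sym e)))) =
      zeroˡ _

  rowFrom-blocked : ∀ B x a b bs d ds → ¬ (d ≤ a + b × a + b ∸ d ≤ B) → rowFrom R α β B x a (b ∷ bs) (d ∷ ds) ≈ 0#
  rowFrom-blocked B x a b bs d ds blocked = ∑-zero (range0 B) no-label
    where
    no-label : ∀ c′ → c′ ∈ range0 B → weight R α β x a b c′ d ⊗ rowFrom R α β B x c′ bs ds ≈ 0#
    no-label c′ c′∈ with (a + b) ≡ᵇ (c′ + d) in eq
    ... | false = zeroˡ _
    ... | true  = ⊥-elim (blocked (subst (d ≤_) (sym e) (m≤n+m d c′) ,
                                   subst (_≤ B) (trans (sym (m+n∸n≡m c′ d)) (cong (_∸ d) (sym e))) (≤-pred (∈-upTo⁻ c′∈))))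
      where
      e = ≡ᵇ-true⇒≡ _ _ eq

  rowFrom-inadmissible : ∀ B x a bs ds → admissibleᵇ B a bs ds ≡ false → rowFrom R α β B x a bs ds ≈ 0#
  rowFrom-inadmissible B x a []       []       e rewrite e = ≈-refl
  rowFrom-inadmissible B x a []       (d ∷ ds) e = ≈-refl
  rowFrom-inadmissible B x a (b ∷ bs) []       e = ≈-refl
  rowFrom-inadmissible B x a (b ∷ bs) (d ∷ ds) e with d ≤? a + b | a + b ∸ d ≤? B
  ... | no d≰  | _      = rowFrom-blocked B x a b bs d ds (λ p → d≰ (proj₁ p))
  ... | yes _  | no c≰B = rowFrom-blocked B x a b bs d ds (λ p → c≰B (proj₂ p))
  ... | yes d≤ | yes c≤B rewrite <ᵇ-true (s≤s d≤) | <ᵇ-true (s≤s c≤B) =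
    ≈-trans (rowFrom-cons B x a b bs d ds d≤ c≤B) (≈-trans (⊗-congˡ (rowFrom-inadmissible B x (a + b ∸ d) bs ds e)) (zeroʳ _))

  module _ {Λ μ : List ℕ} (s : Skew Λ μ) (B : ℕ) (len≤B : length Λ ≤ B) (x : Carrier) where

    rowFrom-skew : ∀ k n → height Λ μ (k + n) ≡ 0 →
      rowFrom R α β B x (height Λ μ k) (multsFrom μ k n) (multsFrom Λ k n)
        ≈ prodFrom (λ j → vertexWeight x (height Λ μ j) (mult Λ j)) k n
    rowFrom-skew k zero    e rewrite trans (cong (height Λ μ) (sym (+-identityʳ k))) e = ≈-refl
    rowFrom-skew k (suc n) e =
      ≈-trans (≈-reflexive (cong₂ (rowFrom R α β B x (height Λ μ k)) (multsFrom-suc μ k n) (multsFrom-suc Λ k n)))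
      (≈-trans (rowFrom-cons B x (height Λ μ k) (mult μ k) (multsFrom μ (suc k) n) (mult Λ k) (multsFrom Λ (suc k) n)
                             (mult≤height+mult s k) (subst (_≤ B) (sym (height-next s k)) (≤-trans (height≤length Λ μ (suc k)) len≤B)))
      (⊗-congˡ (≈-trans (≈-reflexive (cong (λ a → rowFrom R α β B x a (multsFrom μ (suc k) n) (multsFrom Λ (suc k) n))
                                            (height-next s k)))
                        (rowFrom-skew (suc k) n (trans (cong (height Λ μ) (sym (+-suc k n))) e)))))

    rowPF-topBoundary : ∀ {L} → All (_≤ L) Λ → rowPF R α β B x (topBoundary μ L) (topBoundary Λ L) ≈ gSkew R α β x Λ μ
    rowPF-topBoundary {L} bd =
      ≈-trans (∑-applyUpTo-single _ 0 (suc B) (height Λ μ 1) z≤n (s≤s (≤-trans (height≤length Λ μ 1) len≤B)) other-labels)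
      (≈-trans (rowFrom-skew 1 L height-past-L) (≈-sym (gSkew≡prod-vertexWeight x s bd)))
      where
      height-past-L : height Λ μ (1 + L) ≡ 0
      height-past-L = height-beyond {Λ} {μ} (All.map s≤s bd)
      other-labels : ∀ a → a ≢ height Λ μ 1 → rowFrom R α β B x a (topBoundary μ L) (topBoundary Λ L) ≈ 0#
      other-labels a a≢ with admissibleᵇ B a (topBoundary μ L) (topBoundary Λ L) in adm
      ... | false = rowFrom-inadmissible B x a (topBoundary μ L) (topBoundary Λ L) adm
      ... | true  = ⊥-elim (a≢ (+-cancelʳ-≡ (sum bs) a (height Λ μ 1)
                                (trans (admissible-sum B a bs ds adm)
                                       (sym (admissible-sum B (height Λ μ 1) bs ds (skew-admissible s B len≤B 1 L height-past-L))))))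
        where
        bs = topBoundary μ L
        ds = topBoundary Λ L

  latticePF-snoc : ∀ L B n (xs : Vec Carrier (suc (suc n))) bs top →
    latticePF R α β L B xs bs top ≈ ∑ (λ ds → latticePF R α β L B (init xs) bs ds ⊗ rowPF R α β B (last xs) ds top) (allVecs L B)
  latticePF-snoc L B zero    (x ∷ y ∷ [])         bs top = ≈-refl
  latticePF-snoc L B (suc n) (x ∷ y ∷ z ∷ rest) bs top = begin
    ∑ (λ ds → row x bs ds ⊗ latticePF R α β L B (y ∷ z ∷ rest) ds top) V
      ≈⟨ ∑-cong V (λ ds _ → ⊗-congˡ (latticePF-snoc L B n (y ∷ z ∷ rest) ds top)) ⟩
    ∑ (λ ds → row x bs ds ⊗ ∑ (λ es → lower ds es ⊗ row t es top) V) V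
      ≈⟨ ∑-cong V (λ ds _ → ∑-distribˡ (λ es → lower ds es ⊗ row t es top) (row x bs ds) V) ⟩
    ∑ (λ ds → ∑ (λ es → row x bs ds ⊗ (lower ds es ⊗ row t es top)) V) V
      ≈⟨ ∑-swap (λ ds es → row x bs ds ⊗ (lower ds es ⊗ row t es top)) V V ⟩
    ∑ (λ es → ∑ (λ ds → row x bs ds ⊗ (lower ds es ⊗ row t es top)) V) V
      ≈⟨ ∑-cong V (λ es _ → ≈-trans (∑-cong V (λ ds _ → ≈-sym (⊗-assoc _ _ _)))
                                    (≈-sym (∑-distribʳ (λ ds → row x bs ds ⊗ lower ds es) (row t es top) V))) ⟩
    ∑ (λ es → ∑ (λ ds → row x bs ds ⊗ lower ds es) V ⊗ row t es top) V ∎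
    where
    V = allVecs L B
    row = rowPF R α β B
    lower = latticePF R α β L B (init (y ∷ z ∷ rest))
    t = last (z ∷ rest)

  gPoly-no-variables : ∀ Λ (G : List ℕ → Carrier) →
    ∑ (λ μ → gPoly R α β [] μ ⊗ G μ) (subPartitions Λ) ≈ G (replicate (length Λ) 0)
  gPoly-no-variables Λ G = begin
    ∑ (λ μ → gPoly R α β [] μ ⊗ G μ) (subPartitions Λ)   ≈⟨ ∑-cong (subPartitions Λ) only-zeros ⟩
    ∑ (λ μ → if eqListᵇ μ zs then G μ else 0#) (subPartitions Λ)
      ≈⟨ ∑-select (λ μ → eqListᵇ μ zs) G (subPartitions Λ) (countᵇ-subPartitions Λ zs∈) zs∈ (eqListᵇ-refl zs) ⟩
    G zs                                                 ∎
    where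
    zs = replicate (length Λ) 0
    zs∈ = zeros∈subPartitions Λ
    only-zeros : ∀ μ → μ ∈ subPartitions Λ → gPoly R α β [] μ ⊗ G μ ≈ (if eqListᵇ μ zs then G μ else 0#)
    only-zeros μ μ∈ rewrite allZeroᵇ≡eqListᵇ-zeros μ | Pointwise-length (proj₂ (∈-subPartitions⁻ Λ μ∈)) with eqListᵇ μ zs
    ... | true  = ⊗-identityˡ _
    ... | false = zeroˡ _

  module _ (L B : ℕ) where

    top : List ℕ → List ℕ
    top ν = topBoundary ν L

    record Fits (ν : List ℕ) : Set where
      field
        decreasing : Decreasing ν
        bounded    : All (_≤ L) ν
        short      : length ν ≤ B
    open Fits

    subPartition-fits : ∀ {Λ μ} → Fits Λ → μ ∈ subPartitions Λ → Fits μ × Skew Λ μ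
    subPartition-fits {Λ} f μ∈ =
      let dμ , μ⊆Λ = ∈-subPartitions⁻ Λ μ∈ in
      record { decreasing = dμ
             ; bounded    = ⊆ₚ-bounded μ⊆Λ (bounded f)
             ; short      = subst (_≤ B) (sym (Pointwise-length μ⊆Λ)) (short f) } ,
      skew (decreasing f) dμ μ⊆Λ

    rowPF-subPartition : ∀ {Λ μ} → Fits Λ → μ ∈ subPartitions Λ → ∀ y → rowPF R α β B y (top μ) (top Λ) ≈ gSkew R α β y Λ μ
    rowPF-subPartition f μ∈ y = rowPF-topBoundary (proj₂ (subPartition-fits f μ∈)) B (short f) y (bounded f)

    rowPF-support : ∀ {Λ} → Fits Λ → ∀ y ds → ds ∈ allVecs L B →
      rowPF R α β B y ds (top Λ) ≈ 0# ⊎ Σ[ μ ∈ List ℕ ] μ ∈ subPartitions Λ × top μ ≡ ds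
    rowPF-support {Λ} f y ds ds∈ with any (λ a → admissibleᵇ B a ds (top Λ)) (range0 B) in e
    ... | true  = let _ , _ , adm = any-true⁻ (λ a → admissibleᵇ B a ds (top Λ)) (range0 B) e in
                  inj₂ (admissible-bottom-is-subPartition (decreasing f) (bounded f) (allVecs-length ds∈) adm)
    ... | false = inj₁ (∑-zero (range0 B) (λ a a∈ → rowFrom-inadmissible B y a ds (top Λ) (any-false⁻ _ (range0 B) e a a∈)))

    countᵇ-top : ∀ {Λ μ} → Fits Λ → μ ∈ subPartitions Λ → countᵇ (λ ν → eqListᵇ (top ν) (top μ)) (subPartitions Λ) ≡ 1
    countᵇ-top {Λ} {μ} f μ∈ = trans (countᵇ-cong (subPartitions Λ) same-test) (countᵇ-subPartitions Λ μ∈)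
      where
      same-test : ∀ ν → ν ∈ subPartitions Λ → eqListᵇ (top ν) (top μ) ≡ eqListᵇ ν μ
      same-test ν ν∈ with eqListᵇ ν μ in e
      ... | true rewrite eqListᵇ-true⇒≡ ν μ e = eqListᵇ-refl (top μ)
      ... | false with eqListᵇ (top ν) (top μ) in e′
      ...   | false = refl
      ...   | true  = ⊥-elim (eqListᵇ-false⇒≢ e (topBoundary-injective (decreasing fν) (decreasing fμ) same-length
                                                                    (bounded fν) (bounded fμ) (eqListᵇ-true⇒≡ _ _ e′)))
        where
        fν = proj₁ (subPartition-fits f ν∈)
        fμ = proj₁ (subPartition-fits f μ∈)
        same-length : length ν ≡ length μ
        same-length = trans (Pointwise-length (proj₂ (∈-subPartitions⁻ Λ ν∈)))
                            (sym (Pointwise-length (proj₂ (∈-subPartitions⁻ Λ μ∈))))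

    countᵇ-allVecs : ∀ {μ} → Fits μ → countᵇ (λ ds → eqListᵇ (top μ) ds) (allVecs L B) ≡ 1
    countᵇ-allVecs {μ} f =
      trans (countᵇ-cong (allVecs L B) (λ ds _ → eqListᵇ-sym (top μ) ds))
            (trans (cong (countᵇ (λ ds → eqListᵇ ds (top μ))) (allVecs≡boxes L B))
                   (countᵇ-boxes (replicate L B) (topBoundary-⊆ₚ μ L B (short f))))

    ∑-allVecs≡∑-subPartitions : ∀ {Λ} → Fits Λ → ∀ y (G : List ℕ → Carrier) →
      ∑ (λ ds → G ds ⊗ rowPF R α β B y ds (top Λ)) (allVecs L B)
        ≈ ∑ (λ μ → G (top μ) ⊗ rowPF R α β B y (top μ) (top Λ)) (subPartitions Λ)
    ∑-allVecs≡∑-subPartitions {Λ} f y G = begin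
      ∑ F V                                    ≈⟨ ∑-cong V spread ⟩
      ∑ (λ ds → ∑ (λ μ → H μ ds) SP) V         ≈⟨ ∑-swap (λ ds μ → H μ ds) V SP ⟩
      ∑ (λ μ → ∑ (H μ) V) SP                   ≈⟨ ∑-cong SP collect ⟩
      ∑ (λ μ → F (top μ)) SP                   ∎
      where
      V = allVecs L B
      SP = subPartitions Λ
      F = λ ds → G ds ⊗ rowPF R α β B y ds (top Λ)
      H = λ μ ds → if eqListᵇ (top μ) ds then F ds else 0#
      spread : ∀ ds → ds ∈ V → F ds ≈ ∑ (λ μ → H μ ds) SP
      spread ds ds∈ with rowPF-support f y ds ds∈
      ... | inj₁ zero-row = ≈-trans (≈-trans (⊗-congˡ zero-row) (zeroʳ _)) (≈-sym (∑-zero SP vanish))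
        where
        vanish : ∀ μ → μ ∈ SP → H μ ds ≈ 0#
        vanish μ _ with eqListᵇ (top μ) ds
        ... | true  = ≈-trans (⊗-congˡ zero-row) (zeroʳ _)
        ... | false = ≈-refl
      ... | inj₂ (μ , μ∈ , refl) =
        ≈-sym (∑-select (λ ν → eqListᵇ (top ν) (top μ)) (λ _ → F (top μ)) SP (countᵇ-top f μ∈) μ∈ (eqListᵇ-refl (top μ)))
      collect : ∀ μ → μ ∈ SP → ∑ (H μ) V ≈ F (top μ)
      collect μ μ∈ =
        ∑-select (eqListᵇ (top μ)) F V (countᵇ-allVecs fμ) (topBoundary∈allVecs {μ} L B (short fμ)) (eqListᵇ-refl (top μ))
        where
        fμ = proj₁ (subPartition-fits f μ∈)

    gPoly≡latticePF : ∀ n (xs : Vec Carrier (suc n)) Λ → Fits Λ →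
                      gPoly R α β xs Λ ≈ latticePF R α β L B xs (replicate L 0) (top Λ)
    gPoly≡latticePF zero (x ∷ []) Λ f = begin
      ∑ (λ μ → gPoly R α β [] μ ⊗ gSkew R α β x Λ μ) (subPartitions Λ)
        ≈⟨ gPoly-no-variables Λ (gSkew R α β x Λ) ⟩
      gSkew R α β x Λ zs
        ≈⟨ ≈-sym (rowPF-subPartition f zs∈ x) ⟩
      rowPF R α β B x (top zs) (top Λ)
        ≡⟨ cong (λ bs → rowPF R α β B x bs (top Λ)) (topBoundary-zeros (length Λ) L) ⟩
      rowPF R α β B x (replicate L 0) (top Λ) ∎
      where
      zs = replicate (length Λ) 0
      zs∈ = zeros∈subPartitions Λ
    gPoly≡latticePF (suc n) xs Λ f = begin
      ∑ (λ μ → gPoly R α β (init xs) μ ⊗ gSkew R α β (last xs) Λ μ) (subPartitions Λ)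
        ≈⟨ ∑-cong (subPartitions Λ) (λ μ μ∈ → ⊗-cong (gPoly≡latticePF n (init xs) μ (proj₁ (subPartition-fits f μ∈)))
                                                     (≈-sym (rowPF-subPartition f μ∈ (last xs)))) ⟩
      ∑ (λ μ → lower (top μ) ⊗ rowPF R α β B (last xs) (top μ) (top Λ)) (subPartitions Λ)
        ≈⟨ ≈-sym (∑-allVecs≡∑-subPartitions f (last xs) lower) ⟩
      ∑ (λ ds → lower ds ⊗ rowPF R α β B (last xs) ds (top Λ)) (allVecs L B)
        ≈⟨ ≈-sym (latticePF-snoc L B n xs (replicate L 0) (top Λ)) ⟩
      latticePF R α β L B xs (replicate L 0) (top Λ) ∎
      where
      lower : List ℕ → Carrier
      lower = latticePF R α β L B (init xs) (replicate L 0)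

theorem2p2 : ∀ {c ℓ} (R : CommutativeRing c ℓ) →
    let open CommutativeRing R in
    (α β : Carrier) (n : ℕ) (xs : Vec Carrier (suc n)) (λ′ : List ℕ) →
    IsPartition λ′ →
    (L B : ℕ) → All (_≤ L) λ′ → length λ′ ≤ B →
    gPoly R α β xs λ′ ≈ latticePF R α β L B xs (replicate L 0) (topBoundary λ′ L)
theorem2p2 R α β n xs λ′ (decreasing , _) L B bounded short =
  LatticeModel.gPoly≡latticePF R α β L B n xs λ′
    (record { decreasing = Linked⇒AllPairs (λ x≥y y≥z → ≤-trans y≥z x≥y) decreasing ; bounded = bounded ; short = short })
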